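{- The equation algebra is equivalent to the powerset algebra: for every equation algebra expression $e$ there is a powerset algebra expression $e'$, and for every powerset algebra expression $e'$ there is an equation algebra expression $e$, such that $e(B)=e'(B)$ for every database $B$ over any schema containing the relation names occurring free in the expressions.
   Context: Relation types: $0$ is a type; if $\tau_1,\dots,\tau_k$ are types then $(\tau_1,\dots,\tau_k)$ is a type. For a set $D$ of atomic values, a relation of type $0$ on $D$ is an element of $D$; a relation of type $(\tau_1,\dots,\tau_k)$ on $D$ is a finite set of $k$-tuples $(x_1,\dots,x_k)$ with each $x_i$ a relation of type $\tau_i$ on $D$. A database schema is a finite set of relation names, each with a type different from $0$; a database $B$ over a schema $\mathcal S$ consists of a nonempty finite domain $D$ of atomic values together with, for each $R\in\mathcal S$, a relation $R^B$ of the type of $R$ on $D$. The nested relational algebra has the operators union and difference (of relations of the same type), cartesian product, projection, selection for equality of components (equality may be set equality of nested relations), nesting and unnesting. For $R$ of type $(\tau_1,\dots,\tau_k)$ and $i_1,\dots,i_p\in\{1,\dots,k\}$, the nesting $\nu_{i_1,\dots,i_p}(R)$ is the set of tuples $(x_1,\dots,x_k,S)$ with $(x_1,\dots,x_k)\in R$ and $S=\{(y_{i_1},\dots,y_{i_p}) \mid (y_1,\dots,y_k)\in R,\ y_j=x_j \text{ for all } j\notin\{i_1,\dots,i_p\}\}$, of type $(\tau_1,\dots,\tau_k,(\tau_{i_1},\dots,\tau_{i_p}))$. For $\tau_i=(\omega_1,\dots,\omega_\ell)$, the unnesting $\mu_i(R)=\{(x_1,\dots,x_k,y_1,\dots,y_\ell)\mid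 (x_1,\dots,x_k)\in R,\ (y_1,\dots,y_\ell)\in x_i\}$. Expressions are built from relation names and the symbol $D$ (denoting the finite domain of the database). The powerset algebra adds the operator $\Pi$: for $R$ of type $(\tau_1,\dots,\tau_k)$, $\Pi(R)=\{S\mid S\subseteq R\}$, of type $((\tau_1,\dots,\tau_k))$. The equation algebra extends the nested relational algebra with solution expressions: if $e_1,e_2$ are equation algebra expressions and $X_1,\dots,X_p$ are distinct relation names, then $\{(X_1,\dots,X_p)\mid e_1=e_2\}$ is an expression whose free relation names are those free in $e_1$ or $e_2$ other than $X_1,\dots,X_p$ (free names of other constructs are defined as usual; $D$ has none; a name free in an expression may not also become bound in a subexpression). On a database $B$ (over a schema containing the free names) with domain $D$, it evaluates to the set of tuples $(X_1^A,\dots,X_p^A)$ over all databases $A$ over $\{X_1,\dots,X_p\}$ with domain $D$ such that $e_1(B,A)=e_2(B,A)$, where $(B,A)$ is the combined database; its type is $(\tau_1,\dots,\tau_p)$ with $\tau_i$ the type of $X_i$. -}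

module Defs where

open import Data.Bool using (Bool; true; false; _∧_; _∨_; not; if_then_else_)
open import Data.Nat using (ℕ; _≡ᵇ_)
open import Data.Fin using (Fin; zero; suc; _≟_)
open import Data.List using (List; []; _∷_; _++_; map; concatMap; filter; length; lookup; allFin)
open import Data.List.Membership.Propositional using (_∈_)
open import Data.List.Relation.Unary.All as All using (All; []; _∷_)
open import Data.List.Relation.Unary.Any using (here; there)
open import Relation.Nullary.Decidable using (⌊_⌋)
open import Relation.Binary.PropositionalEquality using (_≡_; subst)

-- Relation types.  `base` is the type 0, `tup (τ₁ ∷ … ∷ τₖ ∷ [])` is
-- the type (τ₁,…,τₖ).

data Ty : Set where
  base : Ty
  tup  : List Ty → Ty

-- A relation of type
-- (τ₁,…,τₖ) is a finite set of k-tuples, represented by a list of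
-- tuples (duplicates and order are irrelevant: all comparisons are
-- made with the set equality `eqV` below).

mutual
  data Val : Ty → Set where
    atom : ℕ → Val base
    rel  : {ts : List Ty} → List (Tup ts) → Val (tup ts)

  data Tup : List Ty → Set where
    []  : Tup []
    _∷_ : {t : Ty} {ts : List Ty} → Val t → Tup ts → Tup (t ∷ ts)

Rel : List Ty → Set
Rel ts = List (Tup ts)

mutual
  eqV : {t : Ty} → Val t → Val t → Bool
  eqV (atom a) (atom b) = a ≡ᵇ b
  eqV (rel xs) (rel ys) = subR xs ys ∧ subR ys xs

  eqT : {ts : List Ty} → Tup ts → Tup ts → Bool
  eqT [] [] = true
  eqT (v ∷ vs) (w ∷ ws) = eqV v w ∧ eqT vs ws

  memR : {ts : List Ty} → Tup ts → Rel ts → Bool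
  memR x [] = false
  memR x (y ∷ ys) = eqT x y ∨ memR x ys

  subR : {ts : List Ty} → Rel ts → Rel ts → Bool
  subR [] ys = true
  subR (x ∷ xs) ys = memR x ys ∧ subR xs ys

eqR : {ts : List Ty} → Rel ts → Rel ts → Bool
eqR xs ys = subR xs ys ∧ subR ys xs

memℕ : ℕ → List ℕ → Bool
memℕ a [] = false
memℕ a (b ∷ bs) = (a ≡ᵇ b) ∨ memℕ a bs

mutual
  onV : List ℕ → {t : Ty} → Val t → Bool
  onV d (atom a) = memℕ a d
  onV d (rel xs) = onR d xs

  onT : List ℕ → {ts : List Ty} → Tup ts → Bool
  onT d [] = true
  onT d (v ∷ vs) = onV d v ∧ onT d vs

  onR : List ℕ → {ts : List Ty} → Rel ts → Bool
  onR d [] = true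
  onR d (x ∷ xs) = onT d x ∧ onR d xs

-- Schemas and databases.  A schema is a list of relation types, each
-- different from 0 (hence of the form (ts)); relation names are
-- de Bruijn positions in the list.

Schema : Set
Schema = List (List Ty)

Inst : Schema → Set
Inst Γ = All Rel Γ

onInst : List ℕ → {Γ : Schema} → Inst Γ → Bool
onInst d [] = true
onInst d (R ∷ Rs) = onR d R ∧ onInst d Rs

OnDomain : List ℕ → {Γ : Schema} → Inst Γ → Set
OnDomain d B = onInst d B ≡ true

_++T_ : {ts us : List Ty} → Tup ts → Tup us → Tup (ts ++ us)
[] ++T ys = ys
(v ∷ xs) ++T ys = v ∷ (xs ++T ys)

lookupT : {ts : List Ty} → Tup ts → (i : Fin (length ts)) → Val (lookup ts i)
lookupT (v ∷ vs) zero = v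
lookupT (v ∷ vs) (suc i) = lookupT vs i

projT : {ts : List Ty} → (is : List (Fin (length ts))) → Tup ts → Tup (map (lookup ts) is)
projT [] x = []
projT (i ∷ is) x = lookupT x i ∷ projT is x

contents : {ts : List Ty} → Val (tup ts) → Rel ts
contents (rel xs) = xs

sublists : {A : Set} → List A → List (List A)
sublists [] = [] ∷ []
sublists (x ∷ xs) = let ss = sublists xs in ss ++ map (x ∷_) ss

memFin : {n : ℕ} → Fin n → List (Fin n) → Bool
memFin i [] = false
memFin i (j ∷ js) = ⌊ i ≟ j ⌋ ∨ memFin i js

allB : {A : Set} → (A → Bool) → List A → Bool
allB p [] = true
allB p (x ∷ xs) = p x ∧ allB p xs

filterB : {A : Set} → (A → Bool) → List A → List A
filterB p [] = []
filterB p (x ∷ xs) = if p x then x ∷ filterB p xs else filterB p xs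

mutual
  enumV : (t : Ty) → List ℕ → List (Val t)
  enumV base d = map atom d
  enumV (tup ts) d = map rel (sublists (enumT ts d))

  enumT : (ts : List Ty) → List ℕ → List (Tup ts)
  enumT [] d = [] ∷ []
  enumT (t ∷ ts) d = concatMap (λ v → map (v ∷_) (enumT ts d)) (enumV t d)

enumInst : (Xs : Schema) → List ℕ → List (Inst Xs)
enumInst [] d = [] ∷ []
enumInst (ts ∷ Xs) d =
  concatMap (λ R → map (R ∷_) (enumInst Xs d)) (sublists (enumT ts d))

_++I_ : {Xs Γ : Schema} → Inst Xs → Inst Γ → Inst (Xs ++ Γ)
[] ++I B = B
(R ∷ A) ++I B = R ∷ (A ++I B)

instTup : {Xs : Schema} → Inst Xs → Tup (map tup Xs)
instTup [] = []
instTup (R ∷ A) = rel R ∷ instTup A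

-- One datatype for both algebras: the shared nested relational
-- algebra operators are available in both, Π only in the powerset
-- algebra (PA), solution expressions only in the equation algebra (EA).
-- `Expr a Γ ts` : expression of algebra a with free relation names
-- among Γ, of type (ts).

data Alg : Set where
  PA EA : Alg

data Expr : Alg → Schema → List Ty → Set where
  var   : {a : Alg} {Γ : Schema} {ts : List Ty} → ts ∈ Γ → Expr a Γ ts
  dom   : {a : Alg} {Γ : Schema} → Expr a Γ (base ∷ [])
  union : {a : Alg} {Γ : Schema} {ts : List Ty} → Expr a Γ ts → Expr a Γ ts → Expr a Γ ts
  diff  : {a : Alg} {Γ : Schema} {ts : List Ty} → Expr a Γ ts → Expr a Γ ts → Expr a Γ ts
  prod  : {a : Alg} {Γ : Schema} {ts us : List Ty} → Expr a Γ ts → Expr a Γ us → Expr a Γ (ts ++ us)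
  proj  : {a : Alg} {Γ : Schema} {ts : List Ty} (is : List (Fin (length ts))) →
          Expr a Γ ts → Expr a Γ (map (lookup ts) is)
  sel   : {a : Alg} {Γ : Schema} {ts : List Ty} (i j : Fin (length ts)) →
          lookup ts i ≡ lookup ts j → Expr a Γ ts → Expr a Γ ts
  nest  : {a : Alg} {Γ : Schema} {ts : List Ty} (is : List (Fin (length ts))) →
          Expr a Γ ts → Expr a Γ (ts ++ (tup (map (lookup ts) is) ∷ []))
  unnest : {a : Alg} {Γ : Schema} {ts : List Ty} (i : Fin (length ts)) (us : List Ty) →
          lookup ts i ≡ tup us → Expr a Γ ts → Expr a Γ (ts ++ us)
  powerset : {Γ : Schema} {ts : List Ty} → Expr PA Γ ts → Expr PA Γ (tup ts ∷ [])
  solve : {Γ : Schema} (Xs : Schema) {us : List Ty} →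
          Expr EA (Xs ++ Γ) us → Expr EA (Xs ++ Γ) us → Expr EA Γ (map tup Xs)

eval : {a : Alg} {Γ : Schema} {ts : List Ty} → Expr a Γ ts → List ℕ → Inst Γ → Rel ts
eval (var x) d B = All.lookup B x
eval dom d B = map (λ n → atom n ∷ []) d
eval (union e₁ e₂) d B = eval e₁ d B ++ eval e₂ d B
eval (diff e₁ e₂) d B = let S = eval e₂ d B in filterB (λ x → not (memR x S)) (eval e₁ d B)
eval (prod e₁ e₂) d B =
  let S = eval e₂ d B in concatMap (λ x → map (x ++T_) S) (eval e₁ d B)
eval (proj is e) d B = map (projT is) (eval e d B)
eval (sel i j p e) d B =
  filterB (λ x → eqV (subst Val p (lookupT x i)) (lookupT x j)) (eval e d B)
eval {ts = _} (nest {ts = ts} is e) d B =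
  let R = eval e d B
      agree = λ (x y : Tup ts) →
        allB (λ j → memFin j is ∨ eqV (lookupT x j) (lookupT y j)) (allFin (length ts))
  in map (λ x → x ++T (rel (map (projT is) (filterB (agree x) R)) ∷ [])) R
eval (unnest i us p e) d B =
  concatMap (λ x → map (x ++T_) (contents (subst Val p (lookupT x i)))) (eval e d B)
eval (powerset e) d B = map (λ S → rel S ∷ []) (sublists (eval e d B))
eval (solve Xs e₁ e₂) d B =
  map instTup (filterB (λ A → eqR (eval e₁ d (A ++I B)) (eval e₂ d (A ++I B)))
                       (enumInst Xs d))

-- Relations are represented by lists, so values are compared up to set
-- equality, which every operator of the algebras respects.
--
-- Powerset to equation algebra: Π e is the set of solutions X of X ∪ e = e.
-- Solutions range over all relations on the domain D, and these include
-- every subset of e(B) because powerset expressions over a database on D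
-- only produce values on D.
--
-- Equation to powerset algebra: an expression e is lifted over a context
-- expression C whose rows c hold, in relation-valued columns, the values of
-- some free names of e; the lifting denotes {c ++ t ∣ c ∈ C, t ∈ e(c)}.
-- For a solution expression {Xs ∣ e₁ = e₂} the context is extended by all
-- candidate values of Xs (enumerated with Π from D), e₁ and e₂ are lifted
-- over the extended context, and a candidate is kept unless it is the
-- prefix of a tuple in exactly one of the two liftings.  The initial
-- context is {()}, the projection of D onto no columns; this is where D
-- must be nonempty.

module Submission where

open import Defs
open import Data.Bool using (Bool; true; false; _∧_; _∨_; not)
open import Data.Bool.Properties using (∧-assoc; ∧-conicalˡ; ∧-conicalʳ; ∨-zeroʳ)
open import Data.Empty using (⊥-elim)
open import Data.Fin using (Fin; zero; suc)
import Data.Fin as Fin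
open import Data.List using (List; []; _∷_; _++_; map; concatMap; length; lookup; allFin; tabulate)
open import Data.List.Properties
  using (map-id; map-∘; ++-assoc; ++-identityʳ; concatMap-map; concatMap-cong; map-concatMap)
open import Data.List.Membership.Propositional using (_∈_; find; lose)
open import Data.List.Membership.Propositional.Properties
  using (∈-++⁺ˡ; ∈-++⁺ʳ; ∈-++⁻; ∈-map⁺; ∈-map⁻; ∈-concatMap⁺; ∈-concatMap⁻)
open import Data.List.Relation.Unary.All as All using (All; []; _∷_)
open import Data.List.Relation.Unary.Any using (here; there)
open import Data.Nat using (ℕ; zero; suc; _≡ᵇ_)
open import Data.Product using (Σ; ∃; _×_; _,_; proj₁; proj₂)
open import Data.Sum using (_⊎_; inj₁; inj₂; [_,_])
open import Function using (id; _∘_)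
open import Relation.Binary.PropositionalEquality hiding ([_])
open import Relation.Nullary using (¬_; Dec; yes; no)

∧-true : ∀ {a b} → a ≡ true → b ≡ true → a ∧ b ≡ true
∧-true refl refl = refl

∨-trueˡ : ∀ {a} b → a ≡ true → a ∨ b ≡ true
∨-trueˡ b refl = refl

∨-trueʳ : ∀ a {b} → b ≡ true → a ∨ b ≡ true
∨-trueʳ a refl = ∨-zeroʳ a

∨-true⁻ : ∀ a {b} → a ∨ b ≡ true → a ≡ true ⊎ b ≡ true
∨-true⁻ true  _ = inj₁ refl
∨-true⁻ false p = inj₂ p

not-true⁺ : ∀ {a} → ¬ a ≡ true → not a ≡ true
not-true⁺ {true}  ¬a = ⊥-elim (¬a refl)
not-true⁺ {false} _  = refl

not-true⁻ : ∀ {a} → not a ≡ true → ¬ a ≡ true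
not-true⁻ {true} () _

true-⇔⇒≡ : ∀ {a b} → (a ≡ true → b ≡ true) → (b ≡ true → a ≡ true) → a ≡ b
true-⇔⇒≡ {true}          a⇒b _   = sym (a⇒b refl)
true-⇔⇒≡ {false} {false} _   _   = refl
true-⇔⇒≡ {false} {true}  _   b⇒a = b⇒a refl

≡ᵇ-refl : ∀ a → (a ≡ᵇ a) ≡ true
≡ᵇ-refl zero    = refl
≡ᵇ-refl (suc a) = ≡ᵇ-refl a

≡ᵇ⇒≡ : ∀ a b → (a ≡ᵇ b) ≡ true → a ≡ b
≡ᵇ⇒≡ zero    zero    _ = refl
≡ᵇ⇒≡ (suc a) (suc b) p = cong suc (≡ᵇ⇒≡ a b p)

memR-here : ∀ {ts} {x y : Tup ts} {R} → y ∈ R → eqT x y ≡ true → memR x R ≡ true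
memR-here {x = x} {R = _ ∷ R} (here refl) x≈y = ∨-trueˡ (memR x R) x≈y
memR-here {x = x} {R = z ∷ R} (there y∈R) x≈y = ∨-trueʳ (eqT x z) (memR-here y∈R x≈y)

memR-witness : ∀ {ts} (x : Tup ts) R → memR x R ≡ true → ∃ λ y → y ∈ R × eqT x y ≡ true
memR-witness x (y ∷ R) p with ∨-true⁻ (eqT x y) p
... | inj₁ x≈y = y , here refl , x≈y
... | inj₂ x∈R with memR-witness x R x∈R
...   | z , z∈R , x≈z = z , there z∈R , x≈z

subR-intro : ∀ {ts} (R S : Rel ts) → (∀ {x} → x ∈ R → memR x S ≡ true) → subR R S ≡ true
subR-intro []      S R⊆S = refl
subR-intro (x ∷ R) S R⊆S = ∧-true (R⊆S (here refl)) (subR-intro R S (R⊆S ∘ there))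

subR-elim : ∀ {ts} (R S : Rel ts) → subR R S ≡ true → ∀ {x} → x ∈ R → memR x S ≡ true
subR-elim (x ∷ R) S p (here refl) = ∧-conicalˡ _ _ p
subR-elim (y ∷ R) S p (there x∈R) = subR-elim R S (∧-conicalʳ _ _ p) x∈R

mutual
  eqV-refl : ∀ {t} (v : Val t) → eqV v v ≡ true
  eqV-refl (atom a) = ≡ᵇ-refl a
  eqV-refl (rel R)  = ∧-true (subR-refl R) (subR-refl R)

  eqT-refl : ∀ {ts} (x : Tup ts) → eqT x x ≡ true
  eqT-refl []      = refl
  eqT-refl (v ∷ x) = ∧-true (eqV-refl v) (eqT-refl x)

  subR-refl : ∀ {ts} (R : Rel ts) → subR R R ≡ true
  subR-refl R = subR-⊆ R id

  subR-⊆ : ∀ {ts} {S : Rel ts} (R : Rel ts) → (∀ {y} → y ∈ R → y ∈ S) → subR R S ≡ true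
  subR-⊆ []      R⊆S = refl
  subR-⊆ (x ∷ R) R⊆S = ∧-true (memR-here (R⊆S (here refl)) (eqT-refl x)) (subR-⊆ R (R⊆S ∘ there))

eqV-sym : ∀ {t} (v w : Val t) → eqV v w ≡ true → eqV w v ≡ true
eqV-sym (atom a) (atom b) p rewrite ≡ᵇ⇒≡ a b p = ≡ᵇ-refl b
eqV-sym (rel R)  (rel S)  p = ∧-true (∧-conicalʳ (subR R S) _ p) (∧-conicalˡ (subR R S) _ p)

eqT-sym : ∀ {ts} (x y : Tup ts) → eqT x y ≡ true → eqT y x ≡ true
eqT-sym []      []      p = refl
eqT-sym (v ∷ x) (w ∷ y) p = ∧-true (eqV-sym v w (∧-conicalˡ _ _ p)) (eqT-sym x y (∧-conicalʳ _ _ p))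

mutual
  eqV-trans : ∀ {t} (u v w : Val t) → eqV u v ≡ true → eqV v w ≡ true → eqV u w ≡ true
  eqV-trans (atom a) (atom b) (atom c) p q rewrite ≡ᵇ⇒≡ a b p | ≡ᵇ⇒≡ b c q = ≡ᵇ-refl c
  eqV-trans (rel R)  (rel S)  (rel U)  p q =
    ∧-true (subR-trans R S U (∧-conicalˡ _ _ p) (∧-conicalˡ _ _ q))
           (subR-trans U S R (∧-conicalʳ _ _ q) (∧-conicalʳ _ _ p))

  eqT-trans : ∀ {ts} (x y z : Tup ts) → eqT x y ≡ true → eqT y z ≡ true → eqT x z ≡ true
  eqT-trans []      []      []      p q = refl
  eqT-trans (u ∷ x) (v ∷ y) (w ∷ z) p q =
    ∧-true (eqV-trans u v w (∧-conicalˡ _ _ p) (∧-conicalˡ _ _ q))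
           (eqT-trans x y z (∧-conicalʳ _ _ p) (∧-conicalʳ _ _ q))

  subR-trans : ∀ {ts} (R S U : Rel ts) → subR R S ≡ true → subR S U ≡ true → subR R U ≡ true
  subR-trans []      S U p q = refl
  subR-trans (x ∷ R) S U p q with memR-witness x S (∧-conicalˡ _ _ p)
  ... | y , y∈S , x≈y with memR-witness y U (subR-elim S U q y∈S)
  ...   | z , z∈U , y≈z =
    ∧-true (memR-here z∈U (eqT-trans x y z x≈y y≈z)) (subR-trans R S U (∧-conicalʳ _ _ p) q)

infix 4 _≈ᵛ_ _≈ᵗ_ _∈ʳ_ _⊆ʳ_ _≈ʳ_

-- Records rather than synonyms for the boolean tests, so that the compared values are inferable.
record _≈ᵛ_ {t} (v w : Val t) : Set where
  constructor mk≈ᵛ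
  field eqV-true : eqV v w ≡ true

record _≈ᵗ_ {ts} (x y : Tup ts) : Set where
  constructor mk≈ᵗ
  field eqT-true : eqT x y ≡ true

record _∈ʳ_ {ts} (x : Tup ts) (R : Rel ts) : Set where
  constructor mk∈ʳ
  field memR-true : memR x R ≡ true

open _≈ᵛ_
open _≈ᵗ_
open _∈ʳ_

_⊆ʳ_ : ∀ {ts} → Rel ts → Rel ts → Set
R ⊆ʳ S = ∀ {x} → x ∈ʳ R → x ∈ʳ S

_≈ʳ_ : ∀ {ts} → Rel ts → Rel ts → Set
R ≈ʳ S = R ⊆ʳ S × S ⊆ʳ R

≈ᵛ-refl : ∀ {t} {v : Val t} → v ≈ᵛ v
≈ᵛ-refl {v = v} = mk≈ᵛ (eqV-refl v)

≈ᵛ-sym : ∀ {t} {v w : Val t} → v ≈ᵛ w → w ≈ᵛ v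
≈ᵛ-sym {v = v} {w} (mk≈ᵛ p) = mk≈ᵛ (eqV-sym v w p)

≈ᵛ-trans : ∀ {t} {u v w : Val t} → u ≈ᵛ v → v ≈ᵛ w → u ≈ᵛ w
≈ᵛ-trans {u = u} {v} {w} (mk≈ᵛ p) (mk≈ᵛ q) = mk≈ᵛ (eqV-trans u v w p q)

≈ᵗ-refl : ∀ {ts} {x : Tup ts} → x ≈ᵗ x
≈ᵗ-refl {x = x} = mk≈ᵗ (eqT-refl x)

≈ᵗ-sym : ∀ {ts} {x y : Tup ts} → x ≈ᵗ y → y ≈ᵗ x
≈ᵗ-sym {x = x} {y} (mk≈ᵗ p) = mk≈ᵗ (eqT-sym x y p)

≈ᵗ-trans : ∀ {ts} {x y z : Tup ts} → x ≈ᵗ y → y ≈ᵗ z → x ≈ᵗ z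
≈ᵗ-trans {x = x} {y} {z} (mk≈ᵗ p) (mk≈ᵗ q) = mk≈ᵗ (eqT-trans x y z p q)

≡⇒≈ᵗ : ∀ {ts} {x y : Tup ts} → x ≡ y → x ≈ᵗ y
≡⇒≈ᵗ refl = ≈ᵗ-refl

≈ᵗ-∷⁺ : ∀ {t ts} {v w : Val t} {x y : Tup ts} → v ≈ᵛ w → x ≈ᵗ y → (v ∷ x) ≈ᵗ (w ∷ y)
≈ᵗ-∷⁺ (mk≈ᵛ p) (mk≈ᵗ q) = mk≈ᵗ (∧-true p q)

≈ᵗ-∷⁻ : ∀ {t ts} {v w : Val t} {x y : Tup ts} → (v ∷ x) ≈ᵗ (w ∷ y) → v ≈ᵛ w × x ≈ᵗ y
≈ᵗ-∷⁻ {v = v} {w} (mk≈ᵗ p) = mk≈ᵛ (∧-conicalˡ (eqV v w) _ p) , mk≈ᵗ (∧-conicalʳ (eqV v w) _ p)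

∈ʳ-lose : ∀ {ts} {x y : Tup ts} {R} → y ∈ R → x ≈ᵗ y → x ∈ʳ R
∈ʳ-lose y∈R (mk≈ᵗ x≈y) = mk∈ʳ (memR-here y∈R x≈y)

∈ʳ-find : ∀ {ts} {x : Tup ts} {R} → x ∈ʳ R → ∃ λ y → y ∈ R × x ≈ᵗ y
∈ʳ-find {x = x} {R} (mk∈ʳ p) with memR-witness x R p
... | y , y∈R , x≈y = y , y∈R , mk≈ᵗ x≈y

∈⇒∈ʳ : ∀ {ts} {x : Tup ts} {R} → x ∈ R → x ∈ʳ R
∈⇒∈ʳ x∈R = ∈ʳ-lose x∈R ≈ᵗ-refl

∈ʳ-resp-≈ᵗ : ∀ {ts} {x y : Tup ts} {R} → x ≈ᵗ y → x ∈ʳ R → y ∈ʳ R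
∈ʳ-resp-≈ᵗ x≈y x∈R with ∈ʳ-find x∈R
... | z , z∈R , x≈z = ∈ʳ-lose z∈R (≈ᵗ-trans (≈ᵗ-sym x≈y) x≈z)

_∈ʳ?_ : ∀ {ts} (x : Tup ts) (R : Rel ts) → Dec (x ∈ʳ R)
x ∈ʳ? R with memR x R in x∈R
... | true  = yes (mk∈ʳ x∈R)
... | false = no (not-true⁻ (cong not x∈R) ∘ memR-true)

memR-cong : ∀ {ts} (R : Rel ts) {x y : Tup ts} → x ≈ᵗ y → memR x R ≡ memR y R
memR-cong R x≈y = true-⇔⇒≡ (memR-true ∘ ∈ʳ-resp-≈ᵗ {R = R} x≈y ∘ mk∈ʳ)
                           (memR-true ∘ ∈ʳ-resp-≈ᵗ {R = R} (≈ᵗ-sym x≈y) ∘ mk∈ʳ)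

subR⇒⊆ʳ : ∀ {ts} {R S : Rel ts} → subR R S ≡ true → R ⊆ʳ S
subR⇒⊆ʳ {R = R} {S} p x∈R with ∈ʳ-find x∈R
... | y , y∈R , x≈y = ∈ʳ-resp-≈ᵗ (≈ᵗ-sym x≈y) (mk∈ʳ (subR-elim R S p y∈R))

⊆ʳ⇒subR : ∀ {ts} {R S : Rel ts} → R ⊆ʳ S → subR R S ≡ true
⊆ʳ⇒subR {R = R} {S} R⊆S = subR-intro R S (memR-true ∘ R⊆S ∘ ∈⇒∈ʳ)

eqR⇒≈ʳ : ∀ {ts} {R S : Rel ts} → eqR R S ≡ true → R ≈ʳ S
eqR⇒≈ʳ {R = R} {S} p = subR⇒⊆ʳ (∧-conicalˡ (subR R S) _ p) , subR⇒⊆ʳ (∧-conicalʳ (subR R S) _ p)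

≈ʳ⇒eqR : ∀ {ts} {R S : Rel ts} → R ≈ʳ S → eqR R S ≡ true
≈ʳ⇒eqR (R⊆S , S⊆R) = ∧-true (⊆ʳ⇒subR R⊆S) (⊆ʳ⇒subR S⊆R)

rel-≈ᵛ⇒≈ʳ : ∀ {ts} {R S : Rel ts} → rel R ≈ᵛ rel S → R ≈ʳ S
rel-≈ᵛ⇒≈ʳ (mk≈ᵛ p) = eqR⇒≈ʳ p

≈ʳ⇒rel-≈ᵛ : ∀ {ts} {R S : Rel ts} → R ≈ʳ S → rel R ≈ᵛ rel S
≈ʳ⇒rel-≈ᵛ R≈S = mk≈ᵛ (≈ʳ⇒eqR R≈S)

contents-cong : ∀ {ts} {v w : Val (tup ts)} → v ≈ᵛ w → contents v ≈ʳ contents w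
contents-cong {v = rel R} {rel S} = rel-≈ᵛ⇒≈ʳ

≈ʳ-refl : ∀ {ts} {R : Rel ts} → R ≈ʳ R
≈ʳ-refl = id , id

≈ʳ-sym : ∀ {ts} {R S : Rel ts} → R ≈ʳ S → S ≈ʳ R
≈ʳ-sym (R⊆S , S⊆R) = S⊆R , R⊆S

≈ʳ-trans : ∀ {ts} {R S U : Rel ts} → R ≈ʳ S → S ≈ʳ U → R ≈ʳ U
≈ʳ-trans (R⊆S , S⊆R) (S⊆U , U⊆S) = S⊆U ∘ R⊆S , S⊆R ∘ U⊆S

≡⇒≈ʳ : ∀ {ts} {R S : Rel ts} → R ≡ S → R ≈ʳ S
≡⇒≈ʳ refl = ≈ʳ-refl

eqV-cong : ∀ {t} {v v′ w w′ : Val t} → v ≈ᵛ v′ → w ≈ᵛ w′ → eqV v w ≡ eqV v′ w′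
eqV-cong v≈v′ w≈w′ = true-⇔⇒≡
  (λ p → eqV-true (≈ᵛ-trans (≈ᵛ-sym v≈v′) (≈ᵛ-trans (mk≈ᵛ p) w≈w′)))
  (λ p → eqV-true (≈ᵛ-trans v≈v′ (≈ᵛ-trans (mk≈ᵛ p) (≈ᵛ-sym w≈w′))))

eqR-cong : ∀ {ts} {R R′ S S′ : Rel ts} → R ≈ʳ R′ → S ≈ʳ S′ → eqR R S ≡ eqR R′ S′
eqR-cong R≈R′ S≈S′ = true-⇔⇒≡
  (λ p → ≈ʳ⇒eqR (≈ʳ-trans (≈ʳ-sym R≈R′) (≈ʳ-trans (eqR⇒≈ʳ p) S≈S′)))
  (λ p → ≈ʳ⇒eqR (≈ʳ-trans R≈R′ (≈ʳ-trans (eqR⇒≈ʳ p) (≈ʳ-sym S≈S′))))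

∈-filterB⁺ : ∀ {A : Set} (p : A → Bool) {x} xs → x ∈ xs → p x ≡ true → x ∈ filterB p xs
∈-filterB⁺ p (x ∷ xs) (here refl) px rewrite px = here refl
∈-filterB⁺ p (y ∷ xs) (there x∈xs) px with p y
... | true  = there (∈-filterB⁺ p xs x∈xs px)
... | false = ∈-filterB⁺ p xs x∈xs px

∈-filterB⁻ : ∀ {A : Set} (p : A → Bool) {x} xs → x ∈ filterB p xs → x ∈ xs × p x ≡ true
∈-filterB⁻ p (y ∷ xs) x∈ with p y in py
∈-filterB⁻ p (y ∷ xs) (here refl)  | true  = here refl , py
∈-filterB⁻ p (y ∷ xs) (there x∈)   | true  = let x∈xs , px = ∈-filterB⁻ p xs x∈ in there x∈xs , px
∈-filterB⁻ p (y ∷ xs) x∈           | false = let x∈xs , px = ∈-filterB⁻ p xs x∈ in there x∈xs , px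

filterB-ext : ∀ {A : Set} {p q : A → Bool} → p ≗ q → filterB p ≗ filterB q
filterB-ext         p≗q []       = refl
filterB-ext {q = q} p≗q (x ∷ xs) rewrite p≗q x with q x
... | true  = cong (x ∷_) (filterB-ext p≗q xs)
... | false = filterB-ext p≗q xs

allB-ext : ∀ {A : Set} {p q : A → Bool} → p ≗ q → allB p ≗ allB q
allB-ext p≗q []       = refl
allB-ext p≗q (x ∷ xs) = cong₂ _∧_ (p≗q x) (allB-ext p≗q xs)

∈-sublists⁻ : ∀ {A : Set} {S : List A} R → S ∈ sublists R → ∀ {y} → y ∈ S → y ∈ R
∈-sublists⁻ []      (here refl) ()
∈-sublists⁻ (x ∷ R) S∈ y∈S with ∈-++⁻ (sublists R) S∈
... | inj₁ S∈R = there (∈-sublists⁻ R S∈R y∈S)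
... | inj₂ S∈xR with ∈-map⁻ (x ∷_) S∈xR
∈-sublists⁻ (x ∷ R) S∈ (here refl)  | inj₂ _ | _ , _     , refl = here refl
∈-sublists⁻ (x ∷ R) S∈ (there y∈S′) | inj₂ _ | _ , S′∈R , refl = there (∈-sublists⁻ R S′∈R y∈S′)

filterB∈sublists : ∀ {A : Set} (p : A → Bool) R → filterB p R ∈ sublists R
filterB∈sublists p []      = here refl
filterB∈sublists p (x ∷ R) with p x
... | true  = ∈-++⁺ʳ (sublists R) (∈-map⁺ (x ∷_) (filterB∈sublists p R))
... | false = ∈-++⁺ˡ (filterB∈sublists p R)

≈ᵗ-++T⁺ : ∀ {ts us} {x x′ : Tup ts} {y y′ : Tup us} → x ≈ᵗ x′ → y ≈ᵗ y′ → (x ++T y) ≈ᵗ (x′ ++T y′)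
≈ᵗ-++T⁺ {x = []}    {[]}     _   y≈y′ = y≈y′
≈ᵗ-++T⁺ {x = _ ∷ _} {_ ∷ _} x≈x′ y≈y′ =
  let v≈v′ , x≈x′ = ≈ᵗ-∷⁻ x≈x′ in ≈ᵗ-∷⁺ v≈v′ (≈ᵗ-++T⁺ x≈x′ y≈y′)

≈ᵗ-++T⁻ : ∀ {ts us} {x x′ : Tup ts} {y y′ : Tup us} → (x ++T y) ≈ᵗ (x′ ++T y′) → x ≈ᵗ x′ × y ≈ᵗ y′
≈ᵗ-++T⁻ {x = []}    {[]}     xy≈ = ≈ᵗ-refl , xy≈
≈ᵗ-++T⁻ {x = _ ∷ x} {_ ∷ x′} xy≈ =
  let v≈v′ , xy≈′ = ≈ᵗ-∷⁻ xy≈ ; x≈x′ , y≈y′ = ≈ᵗ-++T⁻ {x = x} {x′} xy≈′ in ≈ᵗ-∷⁺ v≈v′ x≈x′ , y≈y′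

splitT : ∀ ts {us} (z : Tup (ts ++ us)) → Σ (Tup ts) λ x → Σ (Tup us) λ y → z ≡ x ++T y
splitT []       z       = [] , z , refl
splitT (t ∷ ts) (v ∷ z) with splitT ts z
... | x , y , refl = v ∷ x , y , refl

lookupT-cong : ∀ {ts} {x y : Tup ts} (i : Fin (length ts)) → x ≈ᵗ y → lookupT x i ≈ᵛ lookupT y i
lookupT-cong {x = _ ∷ _} {_ ∷ _} zero    x≈y = proj₁ (≈ᵗ-∷⁻ x≈y)
lookupT-cong {x = _ ∷ _} {_ ∷ _} (suc i) x≈y = lookupT-cong i (proj₂ (≈ᵗ-∷⁻ x≈y))

Congruentᵇ : ∀ {ts} → (Tup ts → Bool) → Set
Congruentᵇ p = ∀ {x y} → x ≈ᵗ y → p x ≡ p y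

Congruentᵗ : ∀ {ts us} → (Tup ts → Tup us) → Set
Congruentᵗ f = ∀ {x y} → x ≈ᵗ y → f x ≈ᵗ f y

Congruentʳ : ∀ {ts us} → (Tup ts → Rel us) → Set
Congruentʳ F = ∀ {x y} → x ≈ᵗ y → F x ≈ʳ F y

projT-cong : ∀ {ts} (is : List (Fin (length ts))) → Congruentᵗ (projT {ts} is)
projT-cong      []       x≈y = ≈ᵗ-refl
projT-cong {ts} (i ∷ is) x≈y = ≈ᵗ-∷⁺ (lookupT-cong i x≈y) (projT-cong {ts} is x≈y)

subst-≈ᵛ : ∀ {t u} (p : t ≡ u) {v w : Val t} → v ≈ᵛ w → subst Val p v ≈ᵛ subst Val p w
subst-≈ᵛ refl v≈w = v≈w

_∖ʳ_ : ∀ {ts} → Rel ts → Rel ts → Rel ts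
R ∖ʳ S = filterB (λ x → not (memR x S)) R

Σʳ : ∀ {ts us} → Rel ts → (Tup ts → Rel us) → Rel (ts ++ us)
Σʳ R F = concatMap (λ x → map (x ++T_) (F x)) R

selects : ∀ {ts} (i j : Fin (length ts)) → lookup ts i ≡ lookup ts j → Tup ts → Bool
selects i j p x = eqV (subst Val p (lookupT x i)) (lookupT x j)

agreeOutside : ∀ {ts} → List (Fin (length ts)) → Tup ts → Tup ts → Bool
agreeOutside {ts} is x y = allB (λ j → memFin j is ∨ eqV (lookupT x j) (lookupT y j)) (allFin (length ts))

nestRow : ∀ {ts} (is : List (Fin (length ts))) → Rel ts → Tup ts → Tup (ts ++ (tup (map (lookup ts) is) ∷ []))
nestRow is R x = x ++T (rel (map (projT is) (filterB (agreeOutside is x) R)) ∷ [])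

component : ∀ {ts} (i : Fin (length ts)) (us : List Ty) → lookup ts i ≡ tup us → Tup ts → Rel us
component i us p x = contents (subst Val p (lookupT x i))

powerʳ : ∀ {ts} → Rel ts → Rel (tup ts ∷ [])
powerʳ R = map (λ S → rel S ∷ []) (sublists R)

∈ʳ-++⁺ˡ : ∀ {ts} {x : Tup ts} {R S} → x ∈ʳ R → x ∈ʳ R ++ S
∈ʳ-++⁺ˡ x∈R with ∈ʳ-find x∈R
... | y , y∈R , x≈y = ∈ʳ-lose (∈-++⁺ˡ y∈R) x≈y

∈ʳ-++⁺ʳ : ∀ {ts} {x : Tup ts} R {S} → x ∈ʳ S → x ∈ʳ R ++ S
∈ʳ-++⁺ʳ R x∈S with ∈ʳ-find x∈S
... | y , y∈S , x≈y = ∈ʳ-lose (∈-++⁺ʳ R y∈S) x≈y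

∈ʳ-++⁻ : ∀ {ts} {x : Tup ts} R {S} → x ∈ʳ R ++ S → x ∈ʳ R ⊎ x ∈ʳ S
∈ʳ-++⁻ R x∈ with ∈ʳ-find x∈
... | y , y∈ , x≈y with ∈-++⁻ R y∈
...   | inj₁ y∈R = inj₁ (∈ʳ-lose y∈R x≈y)
...   | inj₂ y∈S = inj₂ (∈ʳ-lose y∈S x≈y)

∈ʳ-filterB⁺ : ∀ {ts} {p : Tup ts → Bool} → Congruentᵇ p → ∀ {x R} → x ∈ʳ R → p x ≡ true → x ∈ʳ filterB p R
∈ʳ-filterB⁺ {p = p} p-cong {R = R} x∈R px with ∈ʳ-find x∈R
... | y , y∈R , x≈y = ∈ʳ-lose (∈-filterB⁺ p R y∈R (trans (sym (p-cong x≈y)) px)) x≈y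

∈ʳ-filterB⁻ : ∀ {ts} {p : Tup ts → Bool} → Congruentᵇ p → ∀ {x R} → x ∈ʳ filterB p R → x ∈ʳ R × p x ≡ true
∈ʳ-filterB⁻ {p = p} p-cong {R = R} x∈ with ∈ʳ-find x∈
... | y , y∈ , x≈y = let y∈R , py = ∈-filterB⁻ p R y∈ in ∈ʳ-lose y∈R x≈y , trans (p-cong x≈y) py

∉-cong : ∀ {ts} (S : Rel ts) → Congruentᵇ (λ x → not (memR x S))
∉-cong S x≈y = cong not (memR-cong S x≈y)

∈ʳ-∖ʳ⁺ : ∀ {ts} {x : Tup ts} {R S} → x ∈ʳ R → ¬ x ∈ʳ S → x ∈ʳ R ∖ʳ S
∈ʳ-∖ʳ⁺ {S = S} x∈R x∉S = ∈ʳ-filterB⁺ (∉-cong S) x∈R (not-true⁺ (x∉S ∘ mk∈ʳ))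

∈ʳ-∖ʳ⁻ : ∀ {ts} {x : Tup ts} {R S} → x ∈ʳ R ∖ʳ S → x ∈ʳ R × ¬ x ∈ʳ S
∈ʳ-∖ʳ⁻ {S = S} x∈ = let x∈R , x∉S = ∈ʳ-filterB⁻ (∉-cong S) x∈ in x∈R , not-true⁻ x∉S ∘ memR-true

∈ʳ-map⁺ : ∀ {ts us} {f : Tup ts → Tup us} → Congruentᵗ f → ∀ {x y R} → y ∈ʳ R → x ≈ᵗ f y → x ∈ʳ map f R
∈ʳ-map⁺ {f = f} f-cong y∈R x≈fy with ∈ʳ-find y∈R
... | z , z∈R , y≈z = ∈ʳ-lose (∈-map⁺ f z∈R) (≈ᵗ-trans x≈fy (f-cong y≈z))

∈ʳ-map⁻ : ∀ {ts us} (f : Tup ts → Tup us) {x} R → x ∈ʳ map f R → ∃ λ y → y ∈ʳ R × x ≈ᵗ f y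
∈ʳ-map⁻ f R x∈ with ∈ʳ-find x∈
... | z , z∈ , x≈z with ∈-map⁻ f z∈
...   | y , y∈R , refl = y , ∈⇒∈ʳ y∈R , x≈z

∈ʳ-Σʳ⁺ : ∀ {ts us} {F : Tup ts → Rel us} → Congruentʳ F → ∀ {x y R} → x ∈ʳ R → y ∈ʳ F x → (x ++T y) ∈ʳ Σʳ R F
∈ʳ-Σʳ⁺ {F = F} F-cong x∈R y∈Fx with ∈ʳ-find x∈R
... | x′ , x′∈R , x≈x′ with ∈ʳ-find (proj₁ (F-cong x≈x′) y∈Fx)
...   | y′ , y′∈Fx′ , y≈y′ =
  ∈ʳ-lose (∈-concatMap⁺ (λ x → map (x ++T_) (F x)) (lose x′∈R (∈-map⁺ (x′ ++T_) y′∈Fx′))) (≈ᵗ-++T⁺ x≈x′ y≈y′)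

∈ʳ-Σʳ⁻ : ∀ {ts us} {F : Tup ts → Rel us} → Congruentʳ F → ∀ {x y R} → (x ++T y) ∈ʳ Σʳ R F → x ∈ʳ R × y ∈ʳ F x
∈ʳ-Σʳ⁻ {F = F} F-cong {x} x++y∈ with ∈ʳ-find x++y∈
... | z , z∈ , x++y≈z with find (∈-concatMap⁻ (λ x → map (x ++T_) (F x)) z∈)
...   | x′ , x′∈R , z∈x′F with ∈-map⁻ (x′ ++T_) z∈x′F
...     | y′ , y′∈Fx′ , refl =
  let x≈x′ , y≈y′ = ≈ᵗ-++T⁻ {x = x} x++y≈z
  in ∈ʳ-lose x′∈R x≈x′ , proj₂ (F-cong x≈x′) (∈ʳ-lose y′∈Fx′ y≈y′)

∈-sublists⇒⊆ʳ : ∀ {ts} {S : Rel ts} R → S ∈ sublists R → S ⊆ʳ R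
∈-sublists⇒⊆ʳ R S∈ x∈S with ∈ʳ-find x∈S
... | y , y∈S , x≈y = ∈ʳ-lose (∈-sublists⁻ R S∈ y∈S) x≈y

filterB-memR≈ʳ : ∀ {ts} {S R : Rel ts} → S ⊆ʳ R → filterB (λ y → memR y S) R ≈ʳ S
filterB-memR≈ʳ {S = S} {R} S⊆R =
  (λ x∈ → mk∈ʳ (proj₂ (∈ʳ-filterB⁻ (memR-cong S) {R = R} x∈))) ,
  (λ x∈S → ∈ʳ-filterB⁺ (memR-cong S) {R = R} (S⊆R x∈S) (memR-true x∈S))

∈ʳ-powerʳ⁺ : ∀ {ts} {S R : Rel ts} → S ⊆ʳ R → (rel S ∷ []) ∈ʳ powerʳ R
∈ʳ-powerʳ⁺ {S = S} {R} S⊆R =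
  ∈ʳ-lose (∈-map⁺ (λ S → rel S ∷ []) (filterB∈sublists (λ y → memR y S) R))
          (≈ᵗ-∷⁺ (≈ʳ⇒rel-≈ᵛ (≈ʳ-sym (filterB-memR≈ʳ S⊆R))) ≈ᵗ-refl)

∈ʳ-powerʳ⁻ : ∀ {ts} {S : Rel ts} R → (rel S ∷ []) ∈ʳ powerʳ R → S ⊆ʳ R
∈ʳ-powerʳ⁻ R S∈ with ∈ʳ-find S∈
... | z , z∈ , S≈z with ∈-map⁻ (λ S → rel S ∷ []) z∈
...   | S′ , S′∈ , refl = ∈-sublists⇒⊆ʳ R S′∈ ∘ proj₁ (rel-≈ᵛ⇒≈ʳ (proj₁ (≈ᵗ-∷⁻ S≈z)))

++-mono : ∀ {ts} {R R′ S S′ : Rel ts} → R ⊆ʳ R′ → S ⊆ʳ S′ → R ++ S ⊆ʳ R′ ++ S′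
++-mono {R = R} {R′} R⊆R′ S⊆S′ x∈ with ∈ʳ-++⁻ R x∈
... | inj₁ x∈R = ∈ʳ-++⁺ˡ (R⊆R′ x∈R)
... | inj₂ x∈S = ∈ʳ-++⁺ʳ R′ (S⊆S′ x∈S)

∖ʳ-mono : ∀ {ts} {R R′ S S′ : Rel ts} → R ⊆ʳ R′ → S′ ⊆ʳ S → R ∖ʳ S ⊆ʳ R′ ∖ʳ S′
∖ʳ-mono R⊆R′ S′⊆S x∈ = let x∈R , x∉S = ∈ʳ-∖ʳ⁻ x∈ in ∈ʳ-∖ʳ⁺ (R⊆R′ x∈R) (x∉S ∘ S′⊆S)

filterB-mono : ∀ {ts} {p : Tup ts → Bool} → Congruentᵇ p → ∀ {R R′} → R ⊆ʳ R′ → filterB p R ⊆ʳ filterB p R′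
filterB-mono p-cong R⊆R′ x∈ = let x∈R , px = ∈ʳ-filterB⁻ p-cong x∈ in ∈ʳ-filterB⁺ p-cong (R⊆R′ x∈R) px

map-mono : ∀ {ts us} {f g : Tup ts → Tup us} → Congruentᵗ g → (∀ x → f x ≈ᵗ g x) →
           ∀ {R R′} → R ⊆ʳ R′ → map f R ⊆ʳ map g R′
map-mono {f = f} g-cong f≈g {R} R⊆R′ x∈ =
  let y , y∈R , x≈fy = ∈ʳ-map⁻ f R x∈ in ∈ʳ-map⁺ g-cong (R⊆R′ y∈R) (≈ᵗ-trans x≈fy (f≈g y))

Σʳ-mono : ∀ {ts us} {F G : Tup ts → Rel us} → Congruentʳ F → Congruentʳ G → (∀ x → F x ⊆ʳ G x) →
          ∀ {R R′} → R ⊆ʳ R′ → Σʳ R F ⊆ʳ Σʳ R′ G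
Σʳ-mono {ts} F-cong G-cong F⊆G R⊆R′ {z} z∈ with splitT ts z
... | x , y , refl = let x∈R , y∈Fx = ∈ʳ-Σʳ⁻ F-cong z∈ in ∈ʳ-Σʳ⁺ G-cong (R⊆R′ x∈R) (F⊆G x y∈Fx)

powerʳ-mono : ∀ {ts} {R R′ : Rel ts} → R ⊆ʳ R′ → powerʳ R ⊆ʳ powerʳ R′
powerʳ-mono {R = R} R⊆R′ {rel S ∷ []} S∈ = ∈ʳ-powerʳ⁺ (R⊆R′ ∘ ∈ʳ-powerʳ⁻ R S∈)

++-cong : ∀ {ts} {R R′ S S′ : Rel ts} → R ≈ʳ R′ → S ≈ʳ S′ → R ++ S ≈ʳ R′ ++ S′
++-cong (R⊆ , R⊇) (S⊆ , S⊇) = ++-mono R⊆ S⊆ , ++-mono R⊇ S⊇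

∖ʳ-cong : ∀ {ts} {R R′ S S′ : Rel ts} → R ≈ʳ R′ → S ≈ʳ S′ → R ∖ʳ S ≈ʳ R′ ∖ʳ S′
∖ʳ-cong (R⊆ , R⊇) (S⊆ , S⊇) = ∖ʳ-mono R⊆ S⊇ , ∖ʳ-mono R⊇ S⊆

filterB-cong : ∀ {ts} {p : Tup ts → Bool} → Congruentᵇ p → ∀ {R R′} → R ≈ʳ R′ → filterB p R ≈ʳ filterB p R′
filterB-cong p-cong (R⊆ , R⊇) = filterB-mono p-cong R⊆ , filterB-mono p-cong R⊇

map-cong-≈ʳ : ∀ {ts us} {f g : Tup ts → Tup us} → Congruentᵗ f → Congruentᵗ g → (∀ x → f x ≈ᵗ g x) →
              ∀ {R R′} → R ≈ʳ R′ → map f R ≈ʳ map g R′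
map-cong-≈ʳ f-cong g-cong f≈g (R⊆ , R⊇) = map-mono g-cong f≈g R⊆ , map-mono f-cong (≈ᵗ-sym ∘ f≈g) R⊇

Σʳ-cong : ∀ {ts us} {F G : Tup ts → Rel us} → Congruentʳ F → Congruentʳ G → (∀ x → F x ≈ʳ G x) →
          ∀ {R R′} → R ≈ʳ R′ → Σʳ R F ≈ʳ Σʳ R′ G
Σʳ-cong F-cong G-cong F≈G (R⊆ , R⊇) =
  Σʳ-mono F-cong G-cong (proj₁ ∘ F≈G) R⊆ , Σʳ-mono G-cong F-cong (proj₂ ∘ F≈G) R⊇

powerʳ-cong : ∀ {ts} {R R′ : Rel ts} → R ≈ʳ R′ → powerʳ R ≈ʳ powerʳ R′
powerʳ-cong (R⊆ , R⊇) = powerʳ-mono R⊆ , powerʳ-mono R⊇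

×ʳ-cong : ∀ {ts us} {R R′ : Rel ts} {S S′ : Rel us} → R ≈ʳ R′ → S ≈ʳ S′ → Σʳ R (λ _ → S) ≈ʳ Σʳ R′ (λ _ → S′)
×ʳ-cong R≈R′ S≈S′ = Σʳ-cong (λ _ → ≈ʳ-refl) (λ _ → ≈ʳ-refl) (λ _ → S≈S′) R≈R′

proj-cong : ∀ {ts} (is : List (Fin (length ts))) {R R′ : Rel ts} → R ≈ʳ R′ → map (projT is) R ≈ʳ map (projT is) R′
proj-cong {ts} is = map-cong-≈ʳ (projT-cong {ts} is) (projT-cong {ts} is) (λ _ → ≈ᵗ-refl)

selects-cong : ∀ {ts} (i j : Fin (length ts)) p → Congruentᵇ (selects {ts} i j p)
selects-cong i j p x≈y = eqV-cong (subst-≈ᵛ p (lookupT-cong i x≈y)) (lookupT-cong j x≈y)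

sel-cong : ∀ {ts} (i j : Fin (length ts)) p {R R′ : Rel ts} → R ≈ʳ R′ →
           filterB (selects i j p) R ≈ʳ filterB (selects i j p) R′
sel-cong i j p = filterB-cong (selects-cong i j p)

agreeOutside-cong : ∀ {ts} (is : List (Fin (length ts))) {x x′ y y′ : Tup ts} → x ≈ᵗ x′ → y ≈ᵗ y′ →
                    agreeOutside is x y ≡ agreeOutside is x′ y′
agreeOutside-cong {ts} is x≈x′ y≈y′ =
  allB-ext (λ j → cong (memFin j is ∨_) (eqV-cong (lookupT-cong j x≈x′) (lookupT-cong j y≈y′))) (allFin (length ts))

nestRow-cong : ∀ {ts} (is : List (Fin (length ts))) (R : Rel ts) → Congruentᵗ (nestRow is R)
nestRow-cong is R x≈y =
  ≈ᵗ-++T⁺ x≈y (≈ᵗ-∷⁺ (≈ʳ⇒rel-≈ᵛ (≡⇒≈ʳ (cong (map (projT is))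
                 (filterB-ext (λ z → agreeOutside-cong is x≈y (≈ᵗ-refl {x = z})) R)))) ≈ᵗ-refl)

agreeOutside-congʳ : ∀ {ts} (is : List (Fin (length ts))) (x : Tup ts) → Congruentᵇ (agreeOutside is x)
agreeOutside-congʳ is x = agreeOutside-cong is (≈ᵗ-refl {x = x})

nestRow-congˡ : ∀ {ts} (is : List (Fin (length ts))) {R R′ : Rel ts} → R ≈ʳ R′ → ∀ x → nestRow is R x ≈ᵗ nestRow is R′ x
nestRow-congˡ is R≈R′ x =
  ≈ᵗ-++T⁺ ≈ᵗ-refl (≈ᵗ-∷⁺ (≈ʳ⇒rel-≈ᵛ (proj-cong is (filterB-cong (agreeOutside-congʳ is x) R≈R′))) ≈ᵗ-refl)

nest-cong : ∀ {ts} (is : List (Fin (length ts))) {R R′ : Rel ts} → R ≈ʳ R′ →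
            map (nestRow is R) R ≈ʳ map (nestRow is R′) R′
nest-cong is {R} {R′} R≈R′ = map-cong-≈ʳ (nestRow-cong is R) (nestRow-cong is R′) (nestRow-congˡ is R≈R′) R≈R′

component-cong : ∀ {ts} (i : Fin (length ts)) us p → Congruentʳ (component {ts} i us p)
component-cong i us p x≈y = contents-cong (subst-≈ᵛ p (lookupT-cong i x≈y))

unnest-cong : ∀ {ts} (i : Fin (length ts)) us p {R R′ : Rel ts} → R ≈ʳ R′ →
              Σʳ R (component i us p) ≈ʳ Σʳ R′ (component i us p)
unnest-cong i us p = Σʳ-cong (component-cong i us p) (component-cong i us p) (λ _ → ≈ʳ-refl)

_≈ⁱ_ : ∀ {Γ} → Inst Γ → Inst Γ → Set
_≈ⁱ_ {Γ} B B′ = ∀ {ts} (m : ts ∈ Γ) → All.lookup B m ≈ʳ All.lookup B′ m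

++I-cong : ∀ {Xs Γ} (A : Inst Xs) {B B′ : Inst Γ} → B ≈ⁱ B′ → (A ++I B) ≈ⁱ (A ++I B′)
++I-cong []      B≈B′ m           = B≈B′ m
++I-cong (R ∷ A) B≈B′ (here refl) = ≈ʳ-refl
++I-cong (R ∷ A) B≈B′ (there m)   = ++I-cong A B≈B′ m

eval-cong : ∀ {a Γ ts} (e : Expr a Γ ts) d {B B′ : Inst Γ} → B ≈ⁱ B′ → eval e d B ≈ʳ eval e d B′
eval-cong (var m)           d B≈B′ = B≈B′ m
eval-cong dom               d B≈B′ = ≈ʳ-refl
eval-cong (union e₁ e₂)     d B≈B′ = ++-cong (eval-cong e₁ d B≈B′) (eval-cong e₂ d B≈B′)
eval-cong (diff e₁ e₂)      d B≈B′ = ∖ʳ-cong (eval-cong e₁ d B≈B′) (eval-cong e₂ d B≈B′)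
eval-cong (prod e₁ e₂)      d B≈B′ = ×ʳ-cong (eval-cong e₁ d B≈B′) (eval-cong e₂ d B≈B′)
eval-cong (proj is e)       d B≈B′ = proj-cong is (eval-cong e d B≈B′)
eval-cong (sel i j p e)     d B≈B′ = sel-cong i j p (eval-cong e d B≈B′)
eval-cong (nest is e)       d B≈B′ = nest-cong is (eval-cong e d B≈B′)
eval-cong (unnest i us p e) d B≈B′ = unnest-cong i us p (eval-cong e d B≈B′)
eval-cong (powerset e)      d B≈B′ = powerʳ-cong (eval-cong e d B≈B′)
eval-cong (solve Xs e₁ e₂)  d B≈B′ = ≡⇒≈ʳ (cong (map instTup) (filterB-ext
  (λ A → eqR-cong (eval-cong e₁ d (++I-cong A B≈B′)) (eval-cong e₂ d (++I-cong A B≈B′))) (enumInst Xs d)))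

memℕ⇒∈ : ∀ n d → memℕ n d ≡ true → n ∈ d
memℕ⇒∈ n (b ∷ d) p with ∨-true⁻ (n ≡ᵇ b) p
... | inj₁ n≡b rewrite ≡ᵇ⇒≡ n b n≡b = here refl
... | inj₂ n∈d = there (memℕ⇒∈ n d n∈d)

∈⇒memℕ : ∀ {n d} → n ∈ d → memℕ n d ≡ true
∈⇒memℕ {n} {_ ∷ d} (here refl) = ∨-trueˡ (memℕ n d) (≡ᵇ-refl n)
∈⇒memℕ {n} {b ∷ d} (there n∈d) = ∨-trueʳ (n ≡ᵇ b) (∈⇒memℕ n∈d)

onR⇒onT : ∀ d {ts} {R : Rel ts} → onR d R ≡ true → ∀ {x} → x ∈ R → onT d x ≡ true
onR⇒onT d {R = x ∷ R} p (here refl) = ∧-conicalˡ (onT d x) _ p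
onR⇒onT d {R = y ∷ R} p (there x∈R) = onR⇒onT d (∧-conicalʳ (onT d y) _ p) x∈R

onT⇒onR : ∀ d {ts} (R : Rel ts) → (∀ {x} → x ∈ R → onT d x ≡ true) → onR d R ≡ true
onT⇒onR d []      _   = refl
onT⇒onR d (x ∷ R) onT = ∧-true (onT (here refl)) (onT⇒onR d R (onT ∘ there))

onInst⇒onR : ∀ d {Γ} (B : Inst Γ) → OnDomain d B → ∀ {ts} (m : ts ∈ Γ) → onR d (All.lookup B m) ≡ true
onInst⇒onR d (R ∷ B) p (here refl) = ∧-conicalˡ (onR d R) _ p
onInst⇒onR d (R ∷ B) p (there m)   = onInst⇒onR d B (∧-conicalʳ (onR d R) _ p) m

onT-++T : ∀ d {ts us} (x : Tup ts) {y : Tup us} → onT d x ≡ true → onT d y ≡ true → onT d (x ++T y) ≡ true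
onT-++T d []      _   y-on = y-on
onT-++T d (v ∷ x) x-on y-on = ∧-true (∧-conicalˡ (onV d v) _ x-on) (onT-++T d x (∧-conicalʳ (onV d v) _ x-on) y-on)

onT-lookupT : ∀ d {ts} (x : Tup ts) (i : Fin (length ts)) → onT d x ≡ true → onV d (lookupT x i) ≡ true
onT-lookupT d (v ∷ x) zero    p = ∧-conicalˡ (onV d v) _ p
onT-lookupT d (v ∷ x) (suc i) p = onT-lookupT d x i (∧-conicalʳ (onV d v) _ p)

onT-projT : ∀ d {ts} (is : List (Fin (length ts))) (x : Tup ts) → onT d x ≡ true → onT d (projT is x) ≡ true
onT-projT d []       x p = refl
onT-projT d (i ∷ is) x p = ∧-true (onT-lookupT d x i p) (onT-projT d is x p)

onT-component : ∀ d {ts} (i : Fin (length ts)) us (p : lookup ts i ≡ tup us) (x : Tup ts) → onT d x ≡ true →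
                ∀ {y} → y ∈ component i us p x → onT d y ≡ true
onT-component d i us p x x-on = onR-contents p (lookupT x i) (onT-lookupT d x i x-on)
  where
  onR-contents : ∀ {t} (q : t ≡ tup us) (v : Val t) → onV d v ≡ true → ∀ {y} → y ∈ contents (subst Val q v) → onT d y ≡ true
  onR-contents refl (rel R) = onR⇒onT d

onT-Σʳ : ∀ d {ts us} {R : Rel ts} {F : Tup ts → Rel us} → (∀ {x} → x ∈ R → onT d x ≡ true) →
         (∀ {x y} → x ∈ R → y ∈ F x → onT d y ≡ true) → ∀ {z} → z ∈ Σʳ R F → onT d z ≡ true
onT-Σʳ d {F = F} R-on F-on z∈ with find (∈-concatMap⁻ (λ x → map (x ++T_) (F x)) z∈)
... | x , x∈R , z∈xF with ∈-map⁻ (x ++T_) z∈xF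
...   | y , y∈Fx , refl = onT-++T d x (R-on x∈R) (F-on x∈R y∈Fx)

onT-nestRow : ∀ d {ts} (is : List (Fin (length ts))) {R : Rel ts} → (∀ {x} → x ∈ R → onT d x ≡ true) →
              ∀ {x} → x ∈ R → onT d (nestRow is R x) ≡ true
onT-nestRow d is {R} R-on {x} x∈R = onT-++T d x (R-on x∈R) (∧-true (onT⇒onR d _ group-on) refl)
  where
  group-on : ∀ {y} → y ∈ map (projT is) (filterB (agreeOutside is x) R) → onT d y ≡ true
  group-on y∈ with ∈-map⁻ (projT is) y∈
  ... | z , z∈ , refl = onT-projT d is z (R-on (proj₁ (∈-filterB⁻ _ R z∈)))

eval-onT : ∀ d {Γ} {B : Inst Γ} → OnDomain d B → ∀ {ts} (e : Expr PA Γ ts) → ∀ {x} → x ∈ eval e d B → onT d x ≡ true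
eval-onT d {B = B} B-on (var m) = onR⇒onT d (onInst⇒onR d B B-on m)
eval-onT d B-on dom x∈ with ∈-map⁻ (λ n → atom n ∷ []) x∈
... | n , n∈d , refl = ∧-true (∈⇒memℕ n∈d) refl
eval-onT d {B = B} B-on (union e₁ e₂) x∈ with ∈-++⁻ (eval e₁ d B) x∈
... | inj₁ x∈₁ = eval-onT d B-on e₁ x∈₁
... | inj₂ x∈₂ = eval-onT d B-on e₂ x∈₂
eval-onT d {B = B} B-on (diff e₁ e₂) x∈ = eval-onT d B-on e₁ (proj₁ (∈-filterB⁻ _ (eval e₁ d B) x∈))
eval-onT d {B = B} B-on (sel i j p e) x∈ = eval-onT d B-on e (proj₁ (∈-filterB⁻ _ (eval e d B) x∈))
eval-onT d B-on (prod e₁ e₂) = onT-Σʳ d (eval-onT d B-on e₁) (λ _ → eval-onT d B-on e₂)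
eval-onT d B-on (proj is e) x∈ with ∈-map⁻ (projT is) x∈
... | y , y∈ , refl = onT-projT d is y (eval-onT d B-on e y∈)
eval-onT d B-on (nest is e) x∈ with ∈-map⁻ _ x∈
... | y , y∈ , refl = onT-nestRow d is (eval-onT d B-on e) y∈
eval-onT d B-on (unnest i us p e) =
  onT-Σʳ d (eval-onT d B-on e) (λ {x} x∈ → onT-component d i us p x (eval-onT d B-on e x∈))
eval-onT d {B = B} B-on (powerset e) x∈ with ∈-map⁻ (λ S → rel S ∷ []) x∈
... | S , S∈ , refl = ∧-true (onT⇒onR d S (eval-onT d B-on e ∘ ∈-sublists⁻ (eval e d B) S∈)) refl

mutual
  enumV-complete : ∀ d {t} (v : Val t) → onV d v ≡ true → ∃ λ w → w ∈ enumV t d × v ≈ᵛ w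
  enumV-complete d (atom n) n-on = atom n , ∈-map⁺ atom (memℕ⇒∈ n d n-on) , ≈ᵛ-refl
  enumV-complete d {tup ts} (rel R) R-on =
    rel (filterB (λ y → memR y R) (enumT ts d)) ,
    ∈-map⁺ rel (filterB∈sublists (λ y → memR y R) (enumT ts d)) ,
    ≈ʳ⇒rel-≈ᵛ (≈ʳ-sym (filterB-memR≈ʳ R⊆enum))
    where
    R⊆enum : R ⊆ʳ enumT ts d
    R⊆enum x∈R with ∈ʳ-find x∈R
    ... | y , y∈R , x≈y = ∈ʳ-resp-≈ᵗ (≈ᵗ-sym x≈y) (enumR-complete d R R-on y∈R)

  enumT-complete : ∀ d {ts} (x : Tup ts) → onT d x ≡ true → x ∈ʳ enumT ts d
  enumT-complete d []                  _    = ∈⇒∈ʳ (here refl)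
  enumT-complete d {t ∷ ts} (v ∷ x) vx-on
    with enumV-complete d v (∧-conicalˡ (onV d v) _ vx-on) | ∈ʳ-find (enumT-complete d x (∧-conicalʳ (onV d v) _ vx-on))
  ... | w , w∈ , v≈w | y , y∈ , x≈y =
    ∈ʳ-lose (∈-concatMap⁺ (λ v → map (v ∷_) (enumT ts d)) (lose w∈ (∈-map⁺ (w ∷_) y∈))) (≈ᵗ-∷⁺ v≈w x≈y)

  enumR-complete : ∀ d {ts} (R : Rel ts) → onR d R ≡ true → ∀ {x} → x ∈ R → x ∈ʳ enumT ts d
  enumR-complete d (x ∷ R) R-on (here refl) = enumT-complete d x (∧-conicalˡ (onT d x) _ R-on)
  enumR-complete d (y ∷ R) R-on (there x∈R) = enumR-complete d R (∧-conicalʳ (onT d y) _ R-on) x∈R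

Ren : Schema → Schema → Set
Ren Γ Δ = ∀ {ts} → ts ∈ Γ → ts ∈ Δ

-- Π e is expressed as { X ∣ X ∪ e = e }; ρ moves the free names of e past the bound X.
toEA : ∀ {Γ Δ ts} → Ren Γ Δ → Expr PA Γ ts → Expr EA Δ ts
toEA ρ (var m)           = var (ρ m)
toEA ρ dom               = dom
toEA ρ (union e₁ e₂)     = union (toEA ρ e₁) (toEA ρ e₂)
toEA ρ (diff e₁ e₂)      = diff (toEA ρ e₁) (toEA ρ e₂)
toEA ρ (prod e₁ e₂)      = prod (toEA ρ e₁) (toEA ρ e₂)
toEA ρ (proj is e)       = proj is (toEA ρ e)
toEA ρ (sel i j p e)     = sel i j p (toEA ρ e)
toEA ρ (nest is e)       = nest is (toEA ρ e)
toEA ρ (unnest i us p e) = unnest i us p (toEA ρ e)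
toEA ρ (powerset {ts = ts} e) =
  solve (ts ∷ []) (union (var (here refl)) (toEA (there ∘ ρ) e)) (toEA (there ∘ ρ) e)

++-absorbs⇒⊆ʳ : ∀ {ts} {S X : Rel ts} → eqR (S ++ X) X ≡ true → S ⊆ʳ X
++-absorbs⇒⊆ʳ p x∈S = proj₁ (eqR⇒≈ʳ p) (∈ʳ-++⁺ˡ x∈S)

⊆ʳ⇒++-absorbs : ∀ {ts} {S X : Rel ts} → S ⊆ʳ X → eqR (S ++ X) X ≡ true
⊆ʳ⇒++-absorbs {S = S} S⊆X = ≈ʳ⇒eqR ((λ x∈ → [ S⊆X , id ] (∈ʳ-++⁻ S x∈)) , ∈ʳ-++⁺ʳ S)

solutions≈powerʳ : ∀ d {ts} {R : Rel ts} (P : Inst (ts ∷ []) → Bool) → R ⊆ʳ enumT ts d →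
                   (∀ S → P (S ∷ []) ≡ true → S ⊆ʳ R) → (∀ S → S ⊆ʳ R → P (S ∷ []) ≡ true) →
                   map instTup (filterB P (enumInst (ts ∷ []) d)) ≈ʳ powerʳ R
solutions≈powerʳ d {ts} {R} P R⊆enum P-sound P-complete = solutions⊆ , solutions⊇
  where
  solutions⊆ : map instTup (filterB P (enumInst (ts ∷ []) d)) ⊆ʳ powerʳ R
  solutions⊆ x∈ with ∈ʳ-find x∈
  ... | _ , z∈ , x≈z with ∈-map⁻ instTup z∈
  ...   | S ∷ [] , A∈ , refl =
    ∈ʳ-resp-≈ᵗ (≈ᵗ-sym x≈z) (∈ʳ-powerʳ⁺ (P-sound S (proj₂ (∈-filterB⁻ P (enumInst (ts ∷ []) d) A∈))))

  solutions⊇ : powerʳ R ⊆ʳ map instTup (filterB P (enumInst (ts ∷ []) d))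
  solutions⊇ {rel S ∷ []} S∈ =
    ∈ʳ-lose (∈-map⁺ instTup (∈-filterB⁺ P (enumInst (ts ∷ []) d) S′∈ (P-complete S′ (S⊆R ∘ proj₁ S′≈S))))
            (≈ᵗ-∷⁺ (≈ʳ⇒rel-≈ᵛ (≈ʳ-sym S′≈S)) ≈ᵗ-refl)
    where
    S⊆R : S ⊆ʳ R
    S⊆R = ∈ʳ-powerʳ⁻ R S∈
    S′ : Rel ts
    S′ = filterB (λ y → memR y S) (enumT ts d)
    S′≈S : S′ ≈ʳ S
    S′≈S = filterB-memR≈ʳ (R⊆enum ∘ S⊆R)
    S′∈ : (S′ ∷ []) ∈ enumInst (ts ∷ []) d
    S′∈ = ∈-concatMap⁺ (λ R → map (R ∷_) (enumInst [] d)) (lose (filterB∈sublists _ (enumT ts d)) (here refl))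

toEA-sound : ∀ d {Γ Δ} (ρ : Ren Γ Δ) {B : Inst Δ} {B′ : Inst Γ} →
             (∀ {ts} (m : ts ∈ Γ) → All.lookup B (ρ m) ≈ʳ All.lookup B′ m) → OnDomain d B′ →
             ∀ {ts} (e : Expr PA Γ ts) → eval (toEA ρ e) d B ≈ʳ eval e d B′
toEA-sound d ρ B≈B′ B′-on (var m)           = B≈B′ m
toEA-sound d ρ B≈B′ B′-on dom               = ≈ʳ-refl
toEA-sound d ρ B≈B′ B′-on (union e₁ e₂)     = ++-cong (toEA-sound d ρ B≈B′ B′-on e₁) (toEA-sound d ρ B≈B′ B′-on e₂)
toEA-sound d ρ B≈B′ B′-on (diff e₁ e₂)      = ∖ʳ-cong (toEA-sound d ρ B≈B′ B′-on e₁) (toEA-sound d ρ B≈B′ B′-on e₂)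
toEA-sound d ρ B≈B′ B′-on (prod e₁ e₂)      = ×ʳ-cong (toEA-sound d ρ B≈B′ B′-on e₁) (toEA-sound d ρ B≈B′ B′-on e₂)
toEA-sound d ρ B≈B′ B′-on (proj is e)       = proj-cong is (toEA-sound d ρ B≈B′ B′-on e)
toEA-sound d ρ B≈B′ B′-on (sel i j p e)     = sel-cong i j p (toEA-sound d ρ B≈B′ B′-on e)
toEA-sound d ρ B≈B′ B′-on (nest is e)       = nest-cong is (toEA-sound d ρ B≈B′ B′-on e)
toEA-sound d ρ B≈B′ B′-on (unnest i us p e) = unnest-cong i us p (toEA-sound d ρ B≈B′ B′-on e)
toEA-sound d ρ {B} {B′} B≈B′ B′-on (powerset {ts = ts} e) =
  solutions≈powerʳ d _ e-in-enum
    (λ S absorbs → proj₁ (body≈ S) ∘ ++-absorbs⇒⊆ʳ absorbs)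
    (λ S S⊆e → ⊆ʳ⇒++-absorbs (proj₂ (body≈ S) ∘ S⊆e))
  where
  body≈ : ∀ S → eval (toEA (there ∘ ρ) e) d (S ∷ B) ≈ʳ eval e d B′
  body≈ S = toEA-sound d (there ∘ ρ) B≈B′ B′-on e
  e-in-enum : eval e d B′ ⊆ʳ enumT ts d
  e-in-enum x∈ with ∈ʳ-find x∈
  ... | y , y∈ , x≈y = ∈ʳ-resp-≈ᵗ (≈ᵗ-sym x≈y) (enumT-complete d y (eval-onT d B′-on e y∈))

subst-∷ : ∀ {k As Bs} (p : As ≡ Bs) (v : Val k) (x : Tup As) → subst Tup (cong (k ∷_) p) (v ∷ x) ≡ v ∷ subst Tup p x
subst-∷ refl v x = refl

subst-∷₂ : ∀ {a b As Bs} (p : a ≡ b) (q : As ≡ Bs) (v : Val a) (x : Tup As) →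
           subst Tup (cong₂ _∷_ p q) (v ∷ x) ≡ subst Val p v ∷ subst Tup q x
subst-∷₂ refl refl v x = refl

subst-≈ᵗ : ∀ {As Bs} (p : As ≡ Bs) → Congruentᵗ (subst Tup p)
subst-≈ᵗ refl x≈y = x≈y

∈ʳ-map-subst⁺ : ∀ {As Bs} (p : As ≡ Bs) {y : Tup As} {L} → y ∈ʳ L → subst Tup p y ∈ʳ map (subst Tup p) L
∈ʳ-map-subst⁺ refl {L = L} y∈L rewrite map-id L = y∈L

∈ʳ-map-subst⁻ : ∀ {As Bs} (p : As ≡ Bs) {y : Tup As} {L} → subst Tup p y ∈ʳ map (subst Tup p) L → y ∈ʳ L
∈ʳ-map-subst⁻ refl {L = L} y∈ rewrite map-id L = y∈

++T-assoc : ∀ {Cs ts us} (c : Tup Cs) (t : Tup ts) (u : Tup us) →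
            subst Tup (++-assoc Cs ts us) ((c ++T t) ++T u) ≡ c ++T (t ++T u)
++T-assoc []                      t u = refl
++T-assoc {k ∷ Cs} {ts} {us} (v ∷ c) t u =
  trans (subst-∷ (++-assoc Cs ts us) v ((c ++T t) ++T u)) (cong (v ∷_) (++T-assoc c t u))

++T-identityʳ : ∀ {K} (x : Tup K) → subst Tup (++-identityʳ K) (x ++T []) ≡ x
++T-identityʳ []              = refl
++T-identityʳ {k ∷ K} (v ∷ x) = trans (subst-∷ (++-identityʳ K) v (x ++T [])) (cong (v ∷_) (++T-identityʳ x))

map-lookup-suc : ∀ {A : Set} (k : A) K (is : List (Fin (length K))) → map (lookup (k ∷ K)) (map suc is) ≡ map (lookup K) is
map-lookup-suc k K []       = refl
map-lookup-suc k K (i ∷ is) = cong (lookup K i ∷_) (map-lookup-suc k K is)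

projT-map-suc : ∀ {k K} (v : Val k) (y : Tup K) (is : List (Fin (length K))) →
                subst Tup (map-lookup-suc k K is) (projT (map suc is) (v ∷ y)) ≡ projT is y
projT-map-suc v y []                 = refl
projT-map-suc {k} {K} v y (i ∷ is) =
  trans (subst-∷ (map-lookup-suc k K is) (lookupT y i) (projT (map suc is) (v ∷ y)))
        (cong (lookupT y i ∷_) (projT-map-suc v y is))

withPrefix : ∀ {A : Set} (Cs : List A) {ts : List A} → List (Fin (length ts)) → List (Fin (length (Cs ++ ts)))
withPrefix []       is = is
withPrefix (c ∷ Cs) is = zero ∷ map suc (withPrefix Cs is)

lookup-withPrefix : ∀ {A : Set} (Cs : List A) {ts} (is : List (Fin (length ts))) →
                    map (lookup (Cs ++ ts)) (withPrefix Cs is) ≡ Cs ++ map (lookup ts) is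
lookup-withPrefix []       is = refl
lookup-withPrefix (c ∷ Cs) {ts} is =
  cong (c ∷_) (trans (map-lookup-suc c (Cs ++ ts) (withPrefix Cs is)) (lookup-withPrefix Cs {ts} is))

projT-withPrefix : ∀ {Cs ts} (is : List (Fin (length ts))) (c : Tup Cs) (t : Tup ts) →
                   subst Tup (lookup-withPrefix Cs {ts} is) (projT (withPrefix Cs is) (c ++T t)) ≡ c ++T projT is t
projT-withPrefix is [] t = refl
projT-withPrefix {k ∷ Cs} {ts} is (v ∷ c) t = begin
  subst Tup (cong (k ∷_) (trans p q)) (v ∷ projT (map suc X) (v ∷ (c ++T t)))
    ≡⟨ subst-∷ (trans p q) v _ ⟩
  v ∷ subst Tup (trans p q) (projT (map suc X) (v ∷ (c ++T t)))
    ≡⟨ cong (v ∷_) (sym (subst-subst {P = Tup} p {q})) ⟩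
  v ∷ subst Tup q (subst Tup p (projT (map suc X) (v ∷ (c ++T t))))
    ≡⟨ cong (λ y → v ∷ subst Tup q y) (projT-map-suc v (c ++T t) X) ⟩
  v ∷ subst Tup q (projT X (c ++T t))
    ≡⟨ cong (v ∷_) (projT-withPrefix {Cs} {ts} is c t) ⟩
  v ∷ (c ++T projT is t) ∎
  where
  open ≡-Reasoning
  X : List (Fin (length (Cs ++ ts)))
  X = withPrefix Cs is
  p : map (lookup (k ∷ Cs ++ ts)) (map suc X) ≡ map (lookup (Cs ++ ts)) X
  p = map-lookup-suc k (Cs ++ ts) X
  q : map (lookup (Cs ++ ts)) X ≡ Cs ++ map (lookup ts) is
  q = lookup-withPrefix Cs {ts} is

lookup-prefix : ∀ {A : Set} (K us : List A) → map (lookup (K ++ us)) (withPrefix K {us} []) ≡ K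
lookup-prefix K us = trans (lookup-withPrefix K {us} []) (++-identityʳ K)

prefixT : ∀ K us → Tup (K ++ us) → Tup K
prefixT K us = subst Tup (lookup-prefix K us) ∘ projT (withPrefix K {us} [])

prefixT-++T : ∀ {K us} (x : Tup K) (y : Tup us) → prefixT K us (x ++T y) ≡ x
prefixT-++T {K} {us} x y = begin
  subst Tup (trans p (++-identityʳ K)) (projT (withPrefix K {us} []) (x ++T y))
    ≡⟨ sym (subst-subst {P = Tup} p {++-identityʳ K}) ⟩
  subst Tup (++-identityʳ K) (subst Tup p (projT (withPrefix K {us} []) (x ++T y)))
    ≡⟨ cong (subst Tup (++-identityʳ K)) (projT-withPrefix {K} {us} [] x y) ⟩
  subst Tup (++-identityʳ K) (x ++T [])
    ≡⟨ ++T-identityʳ x ⟩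
  x ∎
  where
  open ≡-Reasoning
  p : map (lookup (K ++ us)) (withPrefix K {us} []) ≡ K ++ []
  p = lookup-withPrefix K {us} []

shift : ∀ {A : Set} (Cs : List A) {ts : List A} → Fin (length ts) → Fin (length (Cs ++ ts))
shift []       i = i
shift (c ∷ Cs) i = suc (shift Cs i)

lookup-shift : ∀ {A : Set} (Cs : List A) {ts} (i : Fin (length ts)) → lookup (Cs ++ ts) (shift Cs i) ≡ lookup ts i
lookup-shift []       i = refl
lookup-shift (c ∷ Cs) i = lookup-shift Cs i

map-lookup-shift : ∀ {A : Set} (Cs : List A) {ts} (is : List (Fin (length ts))) →
                   map (lookup (Cs ++ ts)) (map (shift Cs) is) ≡ map (lookup ts) is
map-lookup-shift Cs []       = refl
map-lookup-shift Cs (i ∷ is) = cong₂ _∷_ (lookup-shift Cs i) (map-lookup-shift Cs is)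

lookupT-shift : ∀ {Cs ts} (c : Tup Cs) (t : Tup ts) (i : Fin (length ts)) →
                subst Val (lookup-shift Cs i) (lookupT (c ++T t) (shift Cs i)) ≡ lookupT t i
lookupT-shift []      t i = refl
lookupT-shift (v ∷ c) t i = lookupT-shift c t i

projT-shift : ∀ {Cs ts} (is : List (Fin (length ts))) (c : Tup Cs) (t : Tup ts) →
              subst Tup (map-lookup-shift Cs is) (projT (map (shift Cs) is) (c ++T t)) ≡ projT is t
projT-shift         []       c t = refl
projT-shift {Cs} {ts} (i ∷ is) c t =
  trans (subst-∷₂ (lookup-shift Cs i) (map-lookup-shift Cs {ts} is) _ _)
        (cong₂ _∷_ (lookupT-shift c t i) (projT-shift is c t))

eqV-subst-trans : ∀ {A A′ B B′} (a : A′ ≡ A) (p : A ≡ B) (b : B′ ≡ B) (X : Val A′) (Y : Val B′) →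
                  eqV (subst Val (trans a (trans p (sym b))) X) Y ≡ eqV (subst Val p (subst Val a X)) (subst Val b Y)
eqV-subst-trans refl refl refl X Y = refl

selects-shift : ∀ {Cs ts} (i j : Fin (length ts)) (p : lookup ts i ≡ lookup ts j) (c : Tup Cs) (t : Tup ts) →
                selects (shift Cs i) (shift Cs j) (trans (lookup-shift Cs i) (trans p (sym (lookup-shift Cs j)))) (c ++T t)
                ≡ selects i j p t
selects-shift {Cs} i j p c t =
  trans (eqV-subst-trans (lookup-shift Cs i) p (lookup-shift Cs j) _ _)
        (cong₂ (λ X Y → eqV (subst Val p X) Y) (lookupT-shift c t i) (lookupT-shift c t j))

component-shift : ∀ {Cs ts} (i : Fin (length ts)) us (p : lookup ts i ≡ tup us) (c : Tup Cs) (t : Tup ts) →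
                  component (shift Cs i) us (trans (lookup-shift Cs i) p) (c ++T t) ≡ component i us p t
component-shift {Cs} i us p c t =
  cong contents (trans (sym (subst-subst {P = Val} (lookup-shift Cs i))) (cong (subst Val p) (lookupT-shift c t i)))

allB-tabulate : ∀ {A : Set} (P : A → Bool) {n} (f : Fin n → A) → allB P (tabulate f) ≡ allB (P ∘ f) (allFin n)
allB-tabulate P {zero}  f = refl
allB-tabulate P {suc n} f =
  cong (P (f zero) ∧_) (trans (allB-tabulate P (f ∘ Fin.suc)) (sym (allB-tabulate (P ∘ f) Fin.suc)))

memFin-zero-map-suc : ∀ {A : Set} {n} (f : A → Fin n) (X : List A) → memFin zero (map (Fin.suc ∘ f) X) ≡ false
memFin-zero-map-suc f []      = refl
memFin-zero-map-suc f (x ∷ X) = memFin-zero-map-suc f X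

memFin-suc-map-suc : ∀ {A : Set} {n} (j : Fin n) (f : A → Fin n) (X : List A) →
                     memFin (suc j) (map (Fin.suc ∘ f) X) ≡ memFin j (map f X)
memFin-suc-map-suc j f []      = refl
memFin-suc-map-suc j f (x ∷ X) with j Fin.≟ f x
... | yes _ = refl
... | no  _ = memFin-suc-map-suc j f X

agreeOutside-shift : ∀ {Cs ts} (is : List (Fin (length ts))) (c c′ : Tup Cs) (t t′ : Tup ts) →
                     agreeOutside (map (shift Cs) is) (c ++T t) (c′ ++T t′) ≡ eqT c c′ ∧ agreeOutside is t t′
agreeOutside-shift is [] [] t t′ = cong (λ X → agreeOutside X t t′) (map-id is)
agreeOutside-shift {k ∷ Cs} {ts} is (v ∷ c) (v′ ∷ c′) t t′ = begin
  P zero ∧ allB P (tabulate Fin.suc)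
    ≡⟨ cong₂ _∧_ (cong (_∨ eqV v v′) (memFin-zero-map-suc (shift Cs {ts}) is)) (allB-tabulate P Fin.suc) ⟩
  eqV v v′ ∧ allB (P ∘ Fin.suc) (allFin n)
    ≡⟨ cong (eqV v v′ ∧_) (allB-ext (λ j → cong (_∨ eqV (lookupT (c ++T t) j) (lookupT (c′ ++T t′) j))
                                                 (memFin-suc-map-suc j (shift Cs {ts}) is)) (allFin n)) ⟩
  eqV v v′ ∧ agreeOutside (map (shift Cs) is) (c ++T t) (c′ ++T t′)
    ≡⟨ cong (eqV v v′ ∧_) (agreeOutside-shift is c c′ t t′) ⟩
  eqV v v′ ∧ (eqT c c′ ∧ agreeOutside is t t′)
    ≡⟨ sym (∧-assoc (eqV v v′) (eqT c c′) _) ⟩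
  (eqV v v′ ∧ eqT c c′) ∧ agreeOutside is t t′ ∎
  where
  open ≡-Reasoning
  n : ℕ
  n = length (Cs ++ ts)
  P : Fin (suc n) → Bool
  P j = memFin j (map (shift (k ∷ Cs)) is) ∨ eqV (lookupT ((v ∷ c) ++T t) j) (lookupT ((v′ ∷ c′) ++T t′) j)

-- Under a context of type Cs, each name of Δ denotes either the relation
-- stored in a column of the current context row or a relation of the database.
data Loc (Cs : List Ty) (Γ : Schema) (ts : List Ty) : Set where
  col  : tup ts ∈ Cs → Loc Cs Γ ts
  glob : ts ∈ Γ → Loc Cs Γ ts

Env : List Ty → Schema → Schema → Set
Env Cs Γ Δ = ∀ {ts} → ts ∈ Δ → Loc Cs Γ ts

relAt : ∀ {Cs ts} → Tup Cs → tup ts ∈ Cs → Rel ts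
relAt (v ∷ c) (here refl) = contents v
relAt (v ∷ c) (there m)   = relAt c m

locRel : ∀ {Cs Γ ts} → Loc Cs Γ ts → Tup Cs → Inst Γ → Rel ts
locRel (col m)  c B = relAt c m
locRel (glob m) c B = All.lookup B m

envInst : ∀ {Cs Γ Δ} → Env Cs Γ Δ → Tup Cs → Inst Γ → Inst Δ
envInst ρ c B = All.tabulate (λ m → locRel (ρ m) c B)

lookup-tabulate : ∀ {Δ} (f : ∀ {ts} → ts ∈ Δ → Rel ts) {ts} (m : ts ∈ Δ) → All.lookup (All.tabulate f) m ≡ f m
lookup-tabulate f (here refl) = refl
lookup-tabulate f (there m)   = lookup-tabulate (f ∘ there) m

lookup-envInst : ∀ {Cs Γ Δ} (ρ : Env Cs Γ Δ) c B {ts} (m : ts ∈ Δ) → All.lookup (envInst ρ c B) m ≡ locRel (ρ m) c B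
lookup-envInst ρ c B = lookup-tabulate (λ m → locRel (ρ m) c B)

relAt-cong : ∀ {Cs ts} {c c′ : Tup Cs} (m : tup ts ∈ Cs) → c ≈ᵗ c′ → relAt c m ≈ʳ relAt c′ m
relAt-cong {c = _ ∷ _} {_ ∷ _} (here refl) c≈c′ = contents-cong (proj₁ (≈ᵗ-∷⁻ c≈c′))
relAt-cong {c = _ ∷ _} {_ ∷ _} (there m)   c≈c′ = relAt-cong m (proj₂ (≈ᵗ-∷⁻ c≈c′))

locRel-cong : ∀ {Cs Γ ts} (ℓ : Loc Cs Γ ts) {c c′ : Tup Cs} B → c ≈ᵗ c′ → locRel ℓ c B ≈ʳ locRel ℓ c′ B
locRel-cong (col m)  B c≈c′ = relAt-cong m c≈c′
locRel-cong (glob m) B _    = ≈ʳ-refl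

envInst-cong : ∀ {Cs Γ Δ} (ρ : Env Cs Γ Δ) {c c′ : Tup Cs} B → c ≈ᵗ c′ → envInst ρ c B ≈ⁱ envInst ρ c′ B
envInst-cong ρ {c} {c′} B c≈c′ m rewrite lookup-envInst ρ c B m | lookup-envInst ρ c′ B m = locRel-cong (ρ m) B c≈c′

eval-envInst-cong : ∀ d {Cs Γ Δ ts} (ρ : Env Cs Γ Δ) (e : Expr EA Δ ts) B → Congruentʳ (λ c → eval e d (envInst ρ c B))
eval-envInst-cong d ρ e B c≈c′ = eval-cong e d (envInst-cong ρ B c≈c′)

colIndex : ∀ {Cs ts} → tup ts ∈ Cs → Fin (length Cs)
colIndex (here _)  = zero
colIndex (there m) = suc (colIndex m)

lookup-colIndex : ∀ {Cs ts} (m : tup ts ∈ Cs) → lookup Cs (colIndex m) ≡ tup ts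
lookup-colIndex (here refl) = refl
lookup-colIndex (there m)   = lookup-colIndex m

component-colIndex : ∀ {Cs ts} (c : Tup Cs) (m : tup ts ∈ Cs) → component (colIndex m) ts (lookup-colIndex m) c ≡ relAt c m
component-colIndex (v ∷ c) (here refl) = refl
component-colIndex (v ∷ c) (there m)   = component-colIndex c m

relAt-++T⁺ˡ : ∀ {Cs As ts} (c : Tup Cs) (a : Tup As) (m : tup ts ∈ Cs) → relAt (c ++T a) (∈-++⁺ˡ m) ≡ relAt c m
relAt-++T⁺ˡ (v ∷ c) a (here refl) = refl
relAt-++T⁺ˡ (v ∷ c) a (there m)   = relAt-++T⁺ˡ c a m

relAt-++T⁺ʳ : ∀ {Cs As ts} (c : Tup Cs) (a : Tup As) (m : tup ts ∈ As) → relAt (c ++T a) (∈-++⁺ʳ Cs m) ≡ relAt a m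
relAt-++T⁺ʳ []      a m = refl
relAt-++T⁺ʳ (v ∷ c) a m = relAt-++T⁺ʳ c a m

relAt-instTup : ∀ {Ys ts} (A : Inst Ys) (m : ts ∈ Ys) → relAt (instTup A) (∈-map⁺ tup m) ≡ All.lookup A m
relAt-instTup (R ∷ A) (here refl) = refl
relAt-instTup (R ∷ A) (there m)   = relAt-instTup A m

lookup-++I : ∀ {Ys Δ ts} (A : Inst Ys) (I : Inst Δ) (m : ts ∈ Ys ++ Δ) →
             All.lookup (A ++I I) m ≡ [ All.lookup A , All.lookup I ] (∈-++⁻ Ys m)
lookup-++I []      I m           = refl
lookup-++I (R ∷ A) I (here refl) = refl
lookup-++I {Y ∷ Ys} (R ∷ A) I (there m) with ∈-++⁻ Ys m | lookup-++I A I m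
... | inj₁ _ | eq = eq
... | inj₂ _ | eq = eq

record IsΣʳ {Cs ts} (C : Rel Cs) (E : Tup Cs → Rel ts) (L : Rel (Cs ++ ts)) : Set where
  field
    elim  : ∀ c t → (c ++T t) ∈ʳ L → c ∈ʳ C × t ∈ʳ E c
    intro : ∀ c t → c ∈ʳ C → t ∈ʳ E c → (c ++T t) ∈ʳ L

open IsΣʳ

IsΣʳ-resp : ∀ {Cs ts} {C : Rel Cs} {E E′ : Tup Cs → Rel ts} {L} → (∀ c → E c ≈ʳ E′ c) → IsΣʳ C E L → IsΣʳ C E′ L
IsΣʳ-resp E≈E′ s = record
  { elim  = λ c t ct∈ → let c∈ , t∈ = elim s c t ct∈ in c∈ , proj₁ (E≈E′ c) t∈
  ; intro = λ c t c∈ t∈ → intro s c t c∈ (proj₂ (E≈E′ c) t∈)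
  }

IsΣʳ-Σʳ : ∀ {ts us} {F : Tup ts → Rel us} → Congruentʳ F → (R : Rel ts) → IsΣʳ R F (Σʳ R F)
IsΣʳ-Σʳ F-cong R = record
  { elim  = λ c t → ∈ʳ-Σʳ⁻ F-cong
  ; intro = λ c t → ∈ʳ-Σʳ⁺ F-cong
  }

IsΣʳ-++ : ∀ {Cs ts} {C : Rel Cs} {E₁ E₂ : Tup Cs → Rel ts} {L₁ L₂} →
          IsΣʳ C E₁ L₁ → IsΣʳ C E₂ L₂ → IsΣʳ C (λ c → E₁ c ++ E₂ c) (L₁ ++ L₂)
IsΣʳ-++ {E₁ = E₁} {L₁ = L₁} s₁ s₂ = record
  { elim = λ c t ct∈ → [ (λ ct∈₁ → let c∈ , t∈ = elim s₁ c t ct∈₁ in c∈ , ∈ʳ-++⁺ˡ t∈)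
                       , (λ ct∈₂ → let c∈ , t∈ = elim s₂ c t ct∈₂ in c∈ , ∈ʳ-++⁺ʳ (E₁ c) t∈)
                       ] (∈ʳ-++⁻ L₁ ct∈)
  ; intro = λ c t c∈ t∈ → [ (λ t∈₁ → ∈ʳ-++⁺ˡ (intro s₁ c t c∈ t∈₁))
                          , (λ t∈₂ → ∈ʳ-++⁺ʳ L₁ (intro s₂ c t c∈ t∈₂))
                          ] (∈ʳ-++⁻ (E₁ c) t∈)
  }

IsΣʳ-∖ʳ : ∀ {Cs ts} {C : Rel Cs} {E₁ E₂ : Tup Cs → Rel ts} {L₁ L₂} →
          IsΣʳ C E₁ L₁ → IsΣʳ C E₂ L₂ → IsΣʳ C (λ c → E₁ c ∖ʳ E₂ c) (L₁ ∖ʳ L₂)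
IsΣʳ-∖ʳ s₁ s₂ = record
  { elim = λ c t ct∈ → let ct∈₁ , ct∉₂ = ∈ʳ-∖ʳ⁻ ct∈ ; c∈ , t∈₁ = elim s₁ c t ct∈₁
                       in c∈ , ∈ʳ-∖ʳ⁺ t∈₁ (ct∉₂ ∘ intro s₂ c t c∈)
  ; intro = λ c t c∈ t∈ → let t∈₁ , t∉₂ = ∈ʳ-∖ʳ⁻ t∈
                          in ∈ʳ-∖ʳ⁺ (intro s₁ c t c∈ t∈₁) (t∉₂ ∘ proj₂ ∘ elim s₂ c t)
  }

IsΣʳ-filterB : ∀ {Cs ts} {C : Rel Cs} {E : Tup Cs → Rel ts} {L} → IsΣʳ C E L →
               {q : Tup (Cs ++ ts) → Bool} → Congruentᵇ q → {q′ : Tup Cs → Tup ts → Bool} → (∀ c → Congruentᵇ (q′ c)) →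
               (∀ c t → c ∈ʳ C → q (c ++T t) ≡ q′ c t) → IsΣʳ C (λ c → filterB (q′ c) (E c)) (filterB q L)
IsΣʳ-filterB s q-cong q′-cong q≡q′ = record
  { elim = λ c t ct∈ → let ct∈L , q-ct = ∈ʳ-filterB⁻ q-cong ct∈ ; c∈ , t∈ = elim s c t ct∈L
                       in c∈ , ∈ʳ-filterB⁺ (q′-cong c) t∈ (trans (sym (q≡q′ c t c∈)) q-ct)
  ; intro = λ c t c∈ t∈ → let t∈E , q′-t = ∈ʳ-filterB⁻ (q′-cong c) t∈
                          in ∈ʳ-filterB⁺ q-cong (intro s c t c∈ t∈E) (trans (q≡q′ c t c∈) q′-t)
  }

IsΣʳ-map : ∀ {Cs ts us} {C : Rel Cs} {E : Tup Cs → Rel ts} {L} → IsΣʳ C E L → Congruentʳ E →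
           {f : Tup (Cs ++ ts) → Tup (Cs ++ us)} → Congruentᵗ f →
           {g : Tup Cs → Tup ts → Tup us} → (∀ c → Congruentᵗ (g c)) → (∀ {c c′} t → c ≈ᵗ c′ → g c t ≈ᵗ g c′ t) →
           (∀ c t → c ∈ʳ C → t ∈ʳ E c → f (c ++T t) ≈ᵗ (c ++T g c t)) →
           IsΣʳ C (λ c → map (g c) (E c)) (map f L)
IsΣʳ-map {Cs} {C = C} {E} {L} s E-cong {f} f-cong {g} g-cong g-cong′ f≈g = record
  { elim = elim′
  ; intro = λ c t c∈ t∈ → let y , y∈ , t≈gy = ∈ʳ-map⁻ (g c) (E c) t∈
                          in ∈ʳ-map⁺ f-cong (intro s c y c∈ y∈) (≈ᵗ-trans (≈ᵗ-++T⁺ ≈ᵗ-refl t≈gy) (≈ᵗ-sym (f≈g c y c∈ y∈)))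
  }
  where
  elim′ : ∀ c t → (c ++T t) ∈ʳ map f L → c ∈ʳ C × t ∈ʳ map (g c) (E c)
  elim′ c t ct∈ with ∈ʳ-map⁻ f L ct∈
  ... | z , z∈ , ct≈fz with splitT Cs z
  ...   | c₀ , t₀ , refl =
    let c₀∈ , t₀∈ = elim s c₀ t₀ z∈
        c≈c₀ , t≈gt₀ = ≈ᵗ-++T⁻ {x = c} (≈ᵗ-trans ct≈fz (f≈g c₀ t₀ c₀∈ t₀∈))
    in ∈ʳ-resp-≈ᵗ (≈ᵗ-sym c≈c₀) c₀∈ ,
       ∈ʳ-map⁺ (g-cong c) (proj₂ (E-cong c≈c₀) t₀∈) (≈ᵗ-trans t≈gt₀ (g-cong′ t₀ (≈ᵗ-sym c≈c₀)))

∈ʳ-reassoc⁺ : ∀ {Cs ts us} (c : Tup Cs) (t : Tup ts) (u : Tup us) {M} →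
              ((c ++T t) ++T u) ∈ʳ M → (c ++T (t ++T u)) ∈ʳ map (subst Tup (++-assoc Cs ts us)) M
∈ʳ-reassoc⁺ {Cs} {ts} {us} c t u {M} ctu∈ =
  subst (_∈ʳ map (subst Tup (++-assoc Cs ts us)) M) (++T-assoc c t u) (∈ʳ-map-subst⁺ (++-assoc Cs ts us) ctu∈)

∈ʳ-reassoc⁻ : ∀ {Cs ts us} (c : Tup Cs) (t : Tup ts) (u : Tup us) {M} →
              (c ++T (t ++T u)) ∈ʳ map (subst Tup (++-assoc Cs ts us)) M → ((c ++T t) ++T u) ∈ʳ M
∈ʳ-reassoc⁻ {Cs} {ts} {us} c t u {M} ctu∈ =
  ∈ʳ-map-subst⁻ (++-assoc Cs ts us) (subst (_∈ʳ map (subst Tup (++-assoc Cs ts us)) M) (sym (++T-assoc c t u)) ctu∈)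

IsΣʳ-Σʳ-assoc : ∀ {Cs ts us} {C : Rel Cs} {E : Tup Cs → Rel ts} {L} {F′ : Tup (Cs ++ ts) → Rel us} {M}
                {F : Tup Cs → Tup ts → Rel us} → (∀ c → Congruentʳ (F c)) →
                IsΣʳ C E L → IsΣʳ L F′ M → (∀ c t → c ∈ʳ C → F′ (c ++T t) ≈ʳ F c t) →
                IsΣʳ C (λ c → Σʳ (E c) (F c)) (map (subst Tup (++-assoc Cs ts us)) M)
IsΣʳ-Σʳ-assoc {Cs} {ts} {us} {C = C} {E} {M = M} {F} F-cong sL sM F′≈F = record { elim = elim′ ; intro = intro′ }
  where
  elim′ : ∀ c t′ → (c ++T t′) ∈ʳ map (subst Tup (++-assoc Cs ts us)) M → c ∈ʳ C × t′ ∈ʳ Σʳ (E c) (F c)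
  elim′ c t′ ctu∈ with splitT ts t′
  ... | t , u , refl =
    let ct∈ , u∈ = elim sM (c ++T t) u (∈ʳ-reassoc⁻ c t u ctu∈) ; c∈ , t∈ = elim sL c t ct∈
    in c∈ , ∈ʳ-Σʳ⁺ (F-cong c) t∈ (proj₁ (F′≈F c t c∈) u∈)
  intro′ : ∀ c t′ → c ∈ʳ C → t′ ∈ʳ Σʳ (E c) (F c) → (c ++T t′) ∈ʳ map (subst Tup (++-assoc Cs ts us)) M
  intro′ c t′ c∈ tu∈ with splitT ts t′
  ... | t , u , refl =
    let t∈ , u∈ = ∈ʳ-Σʳ⁻ (F-cong c) tu∈
    in ∈ʳ-reassoc⁺ c t u (intro sM (c ++T t) u (intro sL c t c∈ t∈) (proj₂ (F′≈F c t c∈) u∈))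

eval-subst : ∀ {Γ As Bs} (p : As ≡ Bs) (e : Expr PA Γ As) d B → eval (subst (Expr PA Γ) p e) d B ≡ map (subst Tup p) (eval e d B)
eval-subst refl e d B = sym (map-id (eval e d B))

-- Evaluates to {()} on a nonempty domain and to ∅ on the empty one.
unitE : ∀ {Γ} → Expr PA Γ []
unitE = proj [] dom

mutual
  enumTE : ∀ {Γ} ts → Expr PA Γ ts
  enumTE []       = unitE
  enumTE (t ∷ ts) = prod (enumVE t) (enumTE ts)

  enumVE : ∀ {Γ} t → Expr PA Γ (t ∷ [])
  enumVE base     = dom
  enumVE (tup ts) = powerset (enumTE ts)

enumInstE : ∀ {Γ} (Ys : Schema) → Expr PA Γ (map tup Ys)
enumInstE []        = unitE
enumInstE (ts ∷ Ys) = prod (enumVE (tup ts)) (enumInstE Ys)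

eval-unitE : ∀ {d} → d ≢ [] → ∀ {Γ} (B : Inst Γ) → eval (unitE {Γ}) d B ≈ʳ ([] ∷ [])
eval-unitE {[]}    d≢[] B = ⊥-elim (d≢[] refl)
eval-unitE {n ∷ d} d≢[] B = (λ { {[]} _ → ∈⇒∈ʳ (here refl) }) , (λ { {[]} _ → ∈⇒∈ʳ (here refl) })

Σʳ-singletons : ∀ {t ts} (V : List (Val t)) (T : Rel ts) → Σʳ (map (_∷ []) V) (λ _ → T) ≡ concatMap (λ v → map (v ∷_) T) V
Σʳ-singletons V T = concatMap-map (λ x → map (x ++T_) T) (_∷ []) V

mutual
  eval-enumTE : ∀ {d} → d ≢ [] → ∀ {Γ} (B : Inst Γ) ts → eval (enumTE {Γ} ts) d B ≈ʳ enumT ts d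
  eval-enumTE d≢[] B []       = eval-unitE d≢[] B
  eval-enumTE {d} d≢[] B (t ∷ ts) =
    ≈ʳ-trans (×ʳ-cong (eval-enumVE d≢[] B t) (eval-enumTE d≢[] B ts)) (≡⇒≈ʳ (Σʳ-singletons (enumV t d) (enumT ts d)))

  eval-enumVE : ∀ {d} → d ≢ [] → ∀ {Γ} (B : Inst Γ) t → eval (enumVE {Γ} t) d B ≈ʳ map (_∷ []) (enumV t d)
  eval-enumVE {d} d≢[] B base     = ≡⇒≈ʳ (map-∘ d)
  eval-enumVE {d} d≢[] B (tup ts) =
    ≈ʳ-trans (powerʳ-cong (eval-enumTE d≢[] B ts)) (≡⇒≈ʳ (map-∘ (sublists (enumT ts d))))

enumInst-instTup : ∀ d ts Ys → map instTup (enumInst (ts ∷ Ys) d) ≡ Σʳ (map (_∷ []) (enumV (tup ts) d)) (λ _ → map instTup (enumInst Ys d))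
enumInst-instTup d ts Ys = begin
  map instTup (concatMap (λ R → map (R ∷_) As) Ss)
    ≡⟨ map-concatMap instTup (λ R → map (R ∷_) As) Ss ⟩
  concatMap (λ R → map instTup (map (R ∷_) As)) Ss
    ≡⟨ concatMap-cong (λ R → trans (sym (map-∘ As)) (map-∘ As)) Ss ⟩
  concatMap (λ R → map (rel R ∷_) (map instTup As)) Ss
    ≡⟨ sym (concatMap-map (λ v → map (v ∷_) (map instTup As)) rel Ss) ⟩
  concatMap (λ v → map (v ∷_) (map instTup As)) (map rel Ss)
    ≡⟨ sym (Σʳ-singletons (map rel Ss) (map instTup As)) ⟩
  Σʳ (map (_∷ []) (map rel Ss)) (λ _ → map instTup As) ∎
  where
  open ≡-Reasoning
  As : List (Inst Ys)
  As = enumInst Ys d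
  Ss : List (Rel ts)
  Ss = sublists (enumT ts d)

eval-enumInstE : ∀ {d} → d ≢ [] → ∀ {Γ} (B : Inst Γ) Ys → eval (enumInstE {Γ} Ys) d B ≈ʳ map instTup (enumInst Ys d)
eval-enumInstE d≢[] B []            = eval-unitE d≢[] B
eval-enumInstE {d} d≢[] B (ts ∷ Ys) =
  ≈ʳ-trans (×ʳ-cong (eval-enumVE d≢[] B (tup ts)) (eval-enumInstE d≢[] B Ys)) (≡⇒≈ʳ (sym (enumInst-instTup d ts Ys)))

prefixT-cong : ∀ K us → Congruentᵗ (prefixT K us)
prefixT-cong K us = subst-≈ᵗ (lookup-prefix K us) ∘ projT-cong {K ++ us} (withPrefix K [])

prefixE : ∀ {Γ} K us → Expr PA Γ (K ++ us) → Expr PA Γ K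
prefixE K us L = subst (Expr PA _) (lookup-prefix K us) (proj (withPrefix K []) L)

eval-prefixE : ∀ {Γ} K us (L : Expr PA Γ (K ++ us)) d B → eval (prefixE K us L) d B ≡ map (prefixT K us) (eval L d B)
eval-prefixE K us L d B = trans (eval-subst (lookup-prefix K us) (proj (withPrefix K []) L) d B) (sym (map-∘ (eval L d B)))

∈ʳ-map-prefixT⁺ : ∀ {K us} {x : Tup K} (y : Tup us) {L} → (x ++T y) ∈ʳ L → x ∈ʳ map (prefixT K us) L
∈ʳ-map-prefixT⁺ {K} {us} {x} y xy∈ = ∈ʳ-map⁺ (prefixT-cong K us) xy∈ (≡⇒≈ᵗ (sym (prefixT-++T x y)))

∈ʳ-map-prefixT⁻ : ∀ {K us} {x : Tup K} L → x ∈ʳ map (prefixT K us) L → ∃ λ y → (x ++T y) ∈ʳ L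
∈ʳ-map-prefixT⁻ {K} {us} L x∈ with ∈ʳ-map⁻ (prefixT K us) L x∈
... | z , z∈ , x≈z′ with splitT K z
...   | x′ , y , refl = y , ∈ʳ-resp-≈ᵗ (≈ᵗ-++T⁺ (≈ᵗ-sym (≈ᵗ-trans x≈z′ (≡⇒≈ᵗ (prefixT-++T x′ y)))) ≈ᵗ-refl) z∈

wkLoc : ∀ {Cs Γ ts} us → Loc Cs Γ ts → Loc (Cs ++ us) Γ ts
wkLoc us (col m)  = col (∈-++⁺ˡ m)
wkLoc us (glob m) = glob m

wkEnv : ∀ {Cs Γ Δ} us → Env Cs Γ Δ → Env (Cs ++ us) Γ Δ
wkEnv us ρ = wkLoc us ∘ ρ

locRel-wkLoc : ∀ {Cs Γ ts us} (ℓ : Loc Cs Γ ts) (c : Tup Cs) (u : Tup us) B → locRel (wkLoc us ℓ) (c ++T u) B ≡ locRel ℓ c B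
locRel-wkLoc (col m)  c u B = relAt-++T⁺ˡ c u m
locRel-wkLoc (glob m) c u B = refl

envInst-wkEnv : ∀ {Cs Γ Δ us} (ρ : Env Cs Γ Δ) (c : Tup Cs) (u : Tup us) B → envInst (wkEnv us ρ) (c ++T u) B ≈ⁱ envInst ρ c B
envInst-wkEnv {us = us} ρ c u B m = ≡⇒≈ʳ (begin
  All.lookup (envInst (wkEnv us ρ) (c ++T u) B) m ≡⟨ lookup-envInst (wkEnv us ρ) (c ++T u) B m ⟩
  locRel (wkLoc us (ρ m)) (c ++T u) B              ≡⟨ locRel-wkLoc (ρ m) c u B ⟩
  locRel (ρ m) c B                                 ≡⟨ lookup-envInst ρ c B m ⟨
  All.lookup (envInst ρ c B) m                     ∎)
  where open ≡-Reasoning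

bindEnv : ∀ {Cs Γ Δ} Ys → Env Cs Γ Δ → Env (Cs ++ map tup Ys) Γ (Ys ++ Δ)
bindEnv {Cs} Ys ρ m = [ (λ y → col (∈-++⁺ʳ Cs (∈-map⁺ tup y))) , (λ n → wkLoc (map tup Ys) (ρ n)) ] (∈-++⁻ Ys m)

envInst-bindEnv : ∀ {Cs Γ Δ} Ys (ρ : Env Cs Γ Δ) (c : Tup Cs) {a : Tup (map tup Ys)} (A : Inst Ys) B → a ≈ᵗ instTup A →
                  envInst (bindEnv Ys ρ) (c ++T a) B ≈ⁱ (A ++I envInst ρ c B)
envInst-bindEnv {Cs} Ys ρ c {a} A B a≈A m
  rewrite lookup-envInst (bindEnv Ys ρ) (c ++T a) B m | lookup-++I A (envInst ρ c B) m with ∈-++⁻ Ys m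
... | inj₁ y =
  ≈ʳ-trans (≡⇒≈ʳ (relAt-++T⁺ʳ c a (∈-map⁺ tup y))) (≈ʳ-trans (relAt-cong (∈-map⁺ tup y) a≈A) (≡⇒≈ʳ (relAt-instTup A y)))
... | inj₂ n = ≡⇒≈ʳ (trans (locRel-wkLoc (ρ n) c a B) (sym (lookup-envInst ρ c B n)))

agreeing : ∀ {K us} → Rel K → Rel (K ++ us) → Rel (K ++ us) → Rel K
agreeing {K} {us} C L₁ L₂ = C ∖ʳ (map (prefixT K us) (L₁ ∖ʳ L₂) ++ map (prefixT K us) (L₂ ∖ʳ L₁))

agreeingE : ∀ {Γ K us} → Expr PA Γ K → Expr PA Γ (K ++ us) → Expr PA Γ (K ++ us) → Expr PA Γ K
agreeingE {K = K} {us} C L₁ L₂ = diff C (union (prefixE K us (diff L₁ L₂)) (prefixE K us (diff L₂ L₁)))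

eval-agreeingE : ∀ {Γ K us} (C : Expr PA Γ K) (L₁ L₂ : Expr PA Γ (K ++ us)) d B →
                 eval (agreeingE C L₁ L₂) d B ≡ agreeing (eval C d B) (eval L₁ d B) (eval L₂ d B)
eval-agreeingE {K = K} {us} C L₁ L₂ d B =
  cong₂ (λ X Y → eval C d B ∖ʳ (X ++ Y)) (eval-prefixE K us (diff L₁ L₂) d B) (eval-prefixE K us (diff L₂ L₁) d B)

nest-shift-type : ∀ Cs ts (is : List (Fin (length ts))) →
                  (Cs ++ ts) ++ (tup (map (lookup (Cs ++ ts)) (map (shift Cs) is)) ∷ []) ≡ Cs ++ (ts ++ (tup (map (lookup ts) is) ∷ []))
nest-shift-type Cs ts is =
  trans (cong (λ us → (Cs ++ ts) ++ (tup us ∷ [])) (map-lookup-shift Cs is)) (++-assoc Cs ts (tup (map (lookup ts) is) ∷ []))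

liftLoc : ∀ {Cs Γ ts} → Loc Cs Γ ts → Expr PA Γ Cs → Expr PA Γ (Cs ++ ts)
liftLoc (col m)  C = unnest (colIndex m) _ (lookup-colIndex m) C
liftLoc (glob m) C = prod C (var m)

lift : ∀ {Cs Γ Δ ts} → Env Cs Γ Δ → Expr PA Γ Cs → Expr EA Δ ts → Expr PA Γ (Cs ++ ts)
lift ρ C (var m)       = liftLoc (ρ m) C
lift ρ C dom           = prod C dom
lift ρ C (union e₁ e₂) = union (lift ρ C e₁) (lift ρ C e₂)
lift ρ C (diff e₁ e₂)  = diff (lift ρ C e₁) (lift ρ C e₂)
lift {Cs} ρ C (prod {ts = ts} {us} e₁ e₂) =
  subst (Expr PA _) (++-assoc Cs ts us) (lift (wkEnv ts ρ) (lift ρ C e₁) e₂)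
lift {Cs} ρ C (proj is e) =
  subst (Expr PA _) (lookup-withPrefix Cs is) (proj (withPrefix Cs is) (lift ρ C e))
lift {Cs} ρ C (sel i j p e) =
  sel (shift Cs i) (shift Cs j) (trans (lookup-shift Cs i) (trans p (sym (lookup-shift Cs j)))) (lift ρ C e)
lift {Cs} ρ C (nest {ts = ts} is e) =
  subst (Expr PA _) (nest-shift-type Cs ts is) (nest (map (shift Cs) is) (lift ρ C e))
lift {Cs} ρ C (unnest {ts = ts} i us p e) =
  subst (Expr PA _) (++-assoc Cs ts us) (unnest (shift Cs i) us (trans (lookup-shift Cs i) p) (lift ρ C e))
lift ρ C (solve Ys e₁ e₂) =
  agreeingE (prod C (enumInstE Ys)) (lift (bindEnv Ys ρ) (prod C (enumInstE Ys)) e₁) (lift (bindEnv Ys ρ) (prod C (enumInstE Ys)) e₂)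

∉prefix⇒fibre-⊆ʳ : ∀ {K us} {C : Rel K} {F F′ : Tup K → Rel us} {L L′} → IsΣʳ C F L → IsΣʳ C F′ L′ →
                   ∀ {k} → k ∈ʳ C → ¬ k ∈ʳ map (prefixT K us) (L ∖ʳ L′) → F k ⊆ʳ F′ k
∉prefix⇒fibre-⊆ʳ {F′ = F′} s s′ {k} k∈C k∉ {u} u∈F with u ∈ʳ? F′ k
... | yes u∈F′ = u∈F′
... | no  u∉F′ = ⊥-elim (k∉ (∈ʳ-map-prefixT⁺ u (∈ʳ-∖ʳ⁺ (intro s k u k∈C u∈F) (u∉F′ ∘ proj₂ ∘ elim s′ k u))))

fibre-⊆ʳ⇒∉prefix : ∀ {K us} {C : Rel K} {F F′ : Tup K → Rel us} {L L′} → IsΣʳ C F L → IsΣʳ C F′ L′ →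
                   ∀ {k} → F k ⊆ʳ F′ k → ¬ k ∈ʳ map (prefixT K us) (L ∖ʳ L′)
fibre-⊆ʳ⇒∉prefix {L = L} {L′} s s′ {k} F⊆F′ k∈ =
  let u , ku∈ = ∈ʳ-map-prefixT⁻ (L ∖ʳ L′) k∈ ; ku∈L , ku∉L′ = ∈ʳ-∖ʳ⁻ ku∈ ; k∈C , u∈F = elim s k u ku∈L
  in ku∉L′ (intro s′ k u k∈C (F⊆F′ u∈F))

∈ʳ-agreeing⁻ : ∀ {K us} {C : Rel K} {F₁ F₂ : Tup K → Rel us} {L₁ L₂} → IsΣʳ C F₁ L₁ → IsΣʳ C F₂ L₂ →
               ∀ {k} → k ∈ʳ agreeing C L₁ L₂ → k ∈ʳ C × F₁ k ≈ʳ F₂ k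
∈ʳ-agreeing⁻ {K} {us} {L₁ = L₁} {L₂} s₁ s₂ k∈ =
  let k∈C , k∉ = ∈ʳ-∖ʳ⁻ k∈
  in k∈C , ∉prefix⇒fibre-⊆ʳ s₁ s₂ k∈C (k∉ ∘ ∈ʳ-++⁺ˡ) , ∉prefix⇒fibre-⊆ʳ s₂ s₁ k∈C (k∉ ∘ ∈ʳ-++⁺ʳ (map (prefixT K us) (L₁ ∖ʳ L₂)))

∈ʳ-agreeing⁺ : ∀ {K us} {C : Rel K} {F₁ F₂ : Tup K → Rel us} {L₁ L₂} → IsΣʳ C F₁ L₁ → IsΣʳ C F₂ L₂ →
               ∀ {k} → k ∈ʳ C → F₁ k ≈ʳ F₂ k → k ∈ʳ agreeing C L₁ L₂
∈ʳ-agreeing⁺ {K} {us} {L₁ = L₁} {L₂} s₁ s₂ k∈C (F₁⊆F₂ , F₂⊆F₁) =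
  ∈ʳ-∖ʳ⁺ k∈C (λ k∈ → [ fibre-⊆ʳ⇒∉prefix s₁ s₂ F₁⊆F₂ , fibre-⊆ʳ⇒∉prefix s₂ s₁ F₂⊆F₁ ] (∈ʳ-++⁻ (map (prefixT K us) (L₁ ∖ʳ L₂)) k∈))

∈ʳ-map-instTup⁻ : ∀ {Ys} {a : Tup (map tup Ys)} As → a ∈ʳ map instTup As → ∃ λ A → A ∈ As × a ≈ᵗ instTup A
∈ʳ-map-instTup⁻ As a∈ with ∈ʳ-find a∈
... | z , z∈ , a≈z with ∈-map⁻ instTup z∈
...   | A , A∈ , refl = A , A∈ , a≈z

IsΣʳ-solutions : ∀ d {Cs Γ Δ us} Ys (ρ : Env Cs Γ Δ) (e₁ e₂ : Expr EA (Ys ++ Δ) us) B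
                 {C : Rel Cs} {Cand : Rel (map tup Ys)} {L₁ L₂} → Cand ≈ʳ map instTup (enumInst Ys d) →
                 IsΣʳ (Σʳ C (λ _ → Cand)) (λ k → eval e₁ d (envInst (bindEnv Ys ρ) k B)) L₁ →
                 IsΣʳ (Σʳ C (λ _ → Cand)) (λ k → eval e₂ d (envInst (bindEnv Ys ρ) k B)) L₂ →
                 IsΣʳ C (λ c → eval (solve Ys e₁ e₂) d (envInst ρ c B)) (agreeing (Σʳ C (λ _ → Cand)) L₁ L₂)
IsΣʳ-solutions d {Cs} {Γ} {Δ} {us} Ys ρ e₁ e₂ B {C} {Cand} {L₁} {L₂} Cand≈ s₁ s₂ = record { elim = elim′ ; intro = intro′ }
  where
  I : Tup Cs → Inst Δ
  I c = envInst ρ c B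
  solves : Inst Ys → Tup Cs → Bool
  solves A c = eqR (eval e₁ d (A ++I I c)) (eval e₂ d (A ++I I c))
  fibre≈ : ∀ (e : Expr EA (Ys ++ Δ) us) c {a} A → a ≈ᵗ instTup A → eval e d (envInst (bindEnv Ys ρ) (c ++T a) B) ≈ʳ eval e d (A ++I I c)
  fibre≈ e c A a≈A = eval-cong e d (envInst-bindEnv Ys ρ c A B a≈A)

  elim′ : ∀ c a → (c ++T a) ∈ʳ agreeing (Σʳ C (λ _ → Cand)) L₁ L₂ → c ∈ʳ C × a ∈ʳ eval (solve Ys e₁ e₂) d (I c)
  elim′ c a ca∈ =
    let ca∈C′ , F₁≈F₂ = ∈ʳ-agreeing⁻ s₁ s₂ ca∈
        c∈C , a∈Cand = ∈ʳ-Σʳ⁻ (λ _ → ≈ʳ-refl) ca∈C′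
        A , A∈ , a≈A = ∈ʳ-map-instTup⁻ (enumInst Ys d) (proj₁ Cand≈ a∈Cand)
        A-solves = ≈ʳ⇒eqR (≈ʳ-trans (≈ʳ-sym (fibre≈ e₁ c A a≈A)) (≈ʳ-trans F₁≈F₂ (fibre≈ e₂ c A a≈A)))
    in c∈C , ∈ʳ-lose (∈-map⁺ instTup (∈-filterB⁺ (λ A → solves A c) (enumInst Ys d) A∈ A-solves)) a≈A

  intro′ : ∀ c a → c ∈ʳ C → a ∈ʳ eval (solve Ys e₁ e₂) d (I c) → (c ++T a) ∈ʳ agreeing (Σʳ C (λ _ → Cand)) L₁ L₂
  intro′ c a c∈C a∈ =
    let A , A∈′ , a≈A = ∈ʳ-map-instTup⁻ (filterB (λ A → solves A c) (enumInst Ys d)) a∈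
        A∈ , A-solves = ∈-filterB⁻ (λ A → solves A c) (enumInst Ys d) A∈′
        a∈Cand = proj₂ Cand≈ (∈ʳ-lose (∈-map⁺ instTup A∈) a≈A)
        F₁≈F₂ = ≈ʳ-trans (fibre≈ e₁ c A a≈A) (≈ʳ-trans (eqR⇒≈ʳ A-solves) (≈ʳ-sym (fibre≈ e₂ c A a≈A)))
    in ∈ʳ-agreeing⁺ s₁ s₂ (∈ʳ-Σʳ⁺ (λ _ → ≈ʳ-refl) c∈C a∈Cand) F₁≈F₂

subst-++T-nested : ∀ {P A A′} (q : A ≡ A′) (y : Tup P) (Z : Rel A) →
                   subst Tup (cong (λ us → P ++ (tup us ∷ [])) q) (y ++T (rel Z ∷ [])) ≡ y ++T (rel (map (subst Tup q) Z) ∷ [])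
subst-++T-nested refl y Z = cong (λ W → y ++T (rel W ∷ [])) (sym (map-id Z))

subst-nest-shift : ∀ {Cs ts} (is : List (Fin (length ts))) (c : Tup Cs) (t : Tup ts) Z →
                   subst Tup (nest-shift-type Cs ts is) ((c ++T t) ++T (rel Z ∷ []))
                   ≡ c ++T (t ++T (rel (map (subst Tup (map-lookup-shift Cs is)) Z) ∷ []))
subst-nest-shift {Cs} {ts} is c t Z = begin
  subst Tup (trans p (++-assoc Cs ts _)) ((c ++T t) ++T (rel Z ∷ []))
    ≡⟨ sym (subst-subst {P = Tup} p) ⟩
  subst Tup (++-assoc Cs ts _) (subst Tup p ((c ++T t) ++T (rel Z ∷ [])))
    ≡⟨ cong (subst Tup (++-assoc Cs ts _)) (subst-++T-nested (map-lookup-shift Cs is) (c ++T t) Z) ⟩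
  subst Tup (++-assoc Cs ts _) ((c ++T t) ++T (rel (map (subst Tup (map-lookup-shift Cs is)) Z) ∷ []))
    ≡⟨ ++T-assoc c t _ ⟩
  c ++T (t ++T (rel (map (subst Tup (map-lookup-shift Cs is)) Z) ∷ [])) ∎
  where
  open ≡-Reasoning
  p : (Cs ++ ts) ++ (tup (map (lookup (Cs ++ ts)) (map (shift Cs) is)) ∷ []) ≡ (Cs ++ ts) ++ (tup (map (lookup ts) is) ∷ [])
  p = cong (λ us → (Cs ++ ts) ++ (tup us ∷ [])) (map-lookup-shift Cs is)

shiftedProjT : ∀ Cs {ts} (is : List (Fin (length ts))) → Tup (Cs ++ ts) → Tup (map (lookup ts) is)
shiftedProjT Cs is = subst Tup (map-lookup-shift Cs is) ∘ projT (map (shift Cs) is)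

shiftedProjT-cong : ∀ Cs {ts} (is : List (Fin (length ts))) → Congruentᵗ (shiftedProjT Cs is)
shiftedProjT-cong Cs {ts} is = subst-≈ᵗ (map-lookup-shift Cs is) ∘ projT-cong {Cs ++ ts} (map (shift Cs) is)

-- Rows agreeing with c ++ t outside the nested columns share the context row c (agreeOutside-shift).
nest-group : ∀ {Cs ts} (is : List (Fin (length ts))) {C : Rel Cs} {E : Tup Cs → Rel ts} {L} → IsΣʳ C E L → Congruentʳ E →
             ∀ {c} t → c ∈ʳ C →
             map (shiftedProjT Cs is) (filterB (agreeOutside (map (shift Cs) is) (c ++T t)) L)
             ≈ʳ map (projT is) (filterB (agreeOutside is t) (E c))
nest-group {Cs} {ts} is {C} {E} {L} s E-cong {c} t c∈C = group⊆ , group⊇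
  where
  K : List (Fin (length (Cs ++ ts)))
  K = map (shift Cs) is

  group⊆ : map (shiftedProjT Cs is) (filterB (agreeOutside K (c ++T t)) L) ⊆ʳ map (projT is) (filterB (agreeOutside is t) (E c))
  group⊆ x∈ with ∈ʳ-map⁻ (shiftedProjT Cs is) _ x∈
  ... | y , y∈ , x≈y′ with ∈ʳ-filterB⁻ (agreeOutside-congʳ K (c ++T t)) y∈ | splitT Cs y
  ...   | y∈L , agree | c′ , t′ , refl =
    let agree′ = trans (sym (agreeOutside-shift is c c′ t t′)) agree
        c≈c′ = mk≈ᵗ (∧-conicalˡ (eqT c c′) _ agree′)
        t′∈Ec = proj₂ (E-cong c≈c′) (proj₂ (elim s c′ t′ y∈L))
    in ∈ʳ-map⁺ (projT-cong is) (∈ʳ-filterB⁺ (agreeOutside-congʳ is t) t′∈Ec (∧-conicalʳ (eqT c c′) _ agree′))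
               (≈ᵗ-trans x≈y′ (≡⇒≈ᵗ (projT-shift is c′ t′)))

  group⊇ : map (projT is) (filterB (agreeOutside is t) (E c)) ⊆ʳ map (shiftedProjT Cs is) (filterB (agreeOutside K (c ++T t)) L)
  group⊇ x∈ with ∈ʳ-map⁻ (projT is) _ x∈
  ... | t′ , t′∈ , x≈t′ with ∈ʳ-filterB⁻ (agreeOutside-congʳ is t) t′∈
  ...   | t′∈Ec , agree =
    ∈ʳ-map⁺ (shiftedProjT-cong Cs is)
      (∈ʳ-filterB⁺ (agreeOutside-congʳ K (c ++T t)) (intro s c t′ c∈C t′∈Ec)
                   (trans (agreeOutside-shift is c c t t′) (∧-true (eqT-refl c) agree)))
      (≈ᵗ-trans x≈t′ (≡⇒≈ᵗ (sym (projT-shift is c t′))))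

IsΣʳ-nest : ∀ {Cs ts} (is : List (Fin (length ts))) {C : Rel Cs} {E : Tup Cs → Rel ts} {L} → IsΣʳ C E L → Congruentʳ E →
            IsΣʳ C (λ c → map (nestRow is (E c)) (E c))
                   (map (subst Tup (nest-shift-type Cs ts is) ∘ nestRow (map (shift Cs) is) L) L)
IsΣʳ-nest {Cs} {ts} is {C} {E} {L} s E-cong =
  IsΣʳ-map s E-cong (subst-≈ᵗ (nest-shift-type Cs ts is) ∘ nestRow-cong (map (shift Cs) is) L)
    (λ c → nestRow-cong is (E c)) (λ t c≈c′ → nestRow-congˡ is (E-cong c≈c′) t) rowwise
  where
  rowwise : ∀ c t → c ∈ʳ C → t ∈ʳ E c →
            subst Tup (nest-shift-type Cs ts is) (nestRow (map (shift Cs) is) L (c ++T t)) ≈ᵗ (c ++T nestRow is (E c) t)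
  rowwise c t c∈C _ = ≈ᵗ-trans (≡⇒≈ᵗ (subst-nest-shift is c t _))
    (≈ᵗ-++T⁺ (≈ᵗ-refl {x = c}) (≈ᵗ-++T⁺ (≈ᵗ-refl {x = t}) (≈ᵗ-∷⁺ (≈ʳ⇒rel-≈ᵛ group≈) ≈ᵗ-refl)))
    where
    group≈ : map (subst Tup (map-lookup-shift Cs is)) (map (projT (map (shift Cs) is)) (filterB (agreeOutside (map (shift Cs) is) (c ++T t)) L))
             ≈ʳ map (projT is) (filterB (agreeOutside is t) (E c))
    group≈ = ≈ʳ-trans (≡⇒≈ʳ (sym (map-∘ _))) (nest-group is s E-cong t c∈C)

liftLoc-sound : ∀ d {Cs Γ ts} (ℓ : Loc Cs Γ ts) (C : Expr PA Γ Cs) B →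
                IsΣʳ (eval C d B) (λ c → locRel ℓ c B) (eval (liftLoc ℓ C) d B)
liftLoc-sound d (col m)  C B = IsΣʳ-resp (λ c → ≡⇒≈ʳ (component-colIndex c m))
                                         (IsΣʳ-Σʳ (component-cong (colIndex m) _ (lookup-colIndex m)) (eval C d B))
liftLoc-sound d (glob m) C B = IsΣʳ-Σʳ (λ _ → ≈ʳ-refl) (eval C d B)

lift-sound : ∀ {d} → d ≢ [] → ∀ {Cs Γ Δ ts} (ρ : Env Cs Γ Δ) (C : Expr PA Γ Cs) (e : Expr EA Δ ts) B →
             IsΣʳ (eval C d B) (λ c → eval e d (envInst ρ c B)) (eval (lift ρ C e) d B)
lift-sound {d} d≢[] ρ C (var m) B =
  IsΣʳ-resp (λ c → ≡⇒≈ʳ (sym (lookup-envInst ρ c B m))) (liftLoc-sound d (ρ m) C B)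
lift-sound {d} d≢[] ρ C dom B = IsΣʳ-Σʳ (λ _ → ≈ʳ-refl) (eval C d B)
lift-sound d≢[] ρ C (union e₁ e₂) B = IsΣʳ-++ (lift-sound d≢[] ρ C e₁ B) (lift-sound d≢[] ρ C e₂ B)
lift-sound d≢[] ρ C (diff e₁ e₂) B = IsΣʳ-∖ʳ (lift-sound d≢[] ρ C e₁ B) (lift-sound d≢[] ρ C e₂ B)
lift-sound {d} d≢[] {Cs} ρ C (prod {ts = ts} {us} e₁ e₂) B =
  subst (IsΣʳ (eval C d B) _) (sym (eval-subst (++-assoc Cs ts us) (lift (wkEnv ts ρ) (lift ρ C e₁) e₂) d B))
    (IsΣʳ-Σʳ-assoc (λ _ _ → ≈ʳ-refl) (lift-sound d≢[] ρ C e₁ B) (lift-sound d≢[] (wkEnv ts ρ) (lift ρ C e₁) e₂ B)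
                   (λ c t _ → eval-cong e₂ d (envInst-wkEnv ρ c t B)))
lift-sound {d} d≢[] {Cs} ρ C (proj is e) B =
  subst (IsΣʳ (eval C d B) _)
    (sym (trans (eval-subst (lookup-withPrefix Cs is) (proj (withPrefix Cs is) (lift ρ C e)) d B) (sym (map-∘ _))))
    (IsΣʳ-map (lift-sound d≢[] ρ C e B) (eval-envInst-cong d ρ e B)
              (subst-≈ᵗ (lookup-withPrefix Cs is) ∘ projT-cong (withPrefix Cs is))
              (λ _ → projT-cong is) (λ _ _ → ≈ᵗ-refl) (λ c t _ _ → ≡⇒≈ᵗ (projT-withPrefix is c t)))
lift-sound {d} d≢[] {Cs} ρ C (sel i j p e) B =
  IsΣʳ-filterB (lift-sound d≢[] ρ C e B)
               (selects-cong (shift Cs i) (shift Cs j) (trans (lookup-shift Cs i) (trans p (sym (lookup-shift Cs j)))))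
               (λ _ → selects-cong i j p)
               (λ c t _ → selects-shift i j p c t)
lift-sound {d} d≢[] {Cs} ρ C (nest {ts = ts} is e) B =
  subst (IsΣʳ (eval C d B) _)
    (sym (trans (eval-subst (nest-shift-type Cs ts is) (nest (map (shift Cs) is) (lift ρ C e)) d B) (sym (map-∘ _))))
    (IsΣʳ-nest is (lift-sound d≢[] ρ C e B) (eval-envInst-cong d ρ e B))
lift-sound {d} d≢[] {Cs} ρ C (unnest {ts = ts} i us p e) B =
  subst (IsΣʳ (eval C d B) _)
    (sym (eval-subst (++-assoc Cs ts us) (unnest (shift Cs i) us (trans (lookup-shift Cs i) p) (lift ρ C e)) d B))
    (IsΣʳ-Σʳ-assoc (λ _ → component-cong i us p) (lift-sound d≢[] ρ C e B)
                   (IsΣʳ-Σʳ (component-cong (shift Cs i) us (trans (lookup-shift Cs i) p)) _)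
                   (λ c t _ → ≡⇒≈ʳ (component-shift i us p c t)))
lift-sound {d} d≢[] {Cs} {Γ} ρ C (solve Ys e₁ e₂) B =
  subst (IsΣʳ (eval C d B) _) (sym (eval-agreeingE C′ (lift (bindEnv Ys ρ) C′ e₁) (lift (bindEnv Ys ρ) C′ e₂) d B))
    (IsΣʳ-solutions d Ys ρ e₁ e₂ B (eval-enumInstE d≢[] B Ys)
                    (lift-sound d≢[] (bindEnv Ys ρ) C′ e₁ B) (lift-sound d≢[] (bindEnv Ys ρ) C′ e₂ B))
  where
  C′ : Expr PA Γ (Cs ++ map tup Ys)
  C′ = prod C (enumInstE Ys)

IsΣʳ-[] : ∀ {ts} {C : Rel []} {E : Tup [] → Rel ts} {L} → IsΣʳ C E L → [] ∈ʳ C → E [] ≈ʳ L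
IsΣʳ-[] s []∈C = (λ {t} t∈ → intro s [] t []∈C t∈) , (λ {t} t∈ → proj₂ (elim s [] t t∈))

toPA : ∀ {Γ ts} → Expr EA Γ ts → Expr PA Γ ts
toPA = lift glob unitE

toPA-sound : ∀ {d} → d ≢ [] → ∀ {Γ ts} (e : Expr EA Γ ts) (B : Inst Γ) → eval e d B ≈ʳ eval (toPA e) d B
toPA-sound {d} d≢[] e B =
  ≈ʳ-trans (eval-cong e d (≡⇒≈ʳ ∘ sym ∘ lookup-envInst glob [] B))
           (IsΣʳ-[] (lift-sound d≢[] glob unitE e B) (proj₂ (eval-unitE d≢[] B) (∈⇒∈ʳ (here refl))))

proposition4p4 :
    ((Γ : Schema) (ts : List Ty) (e : Expr EA Γ ts) →
      Σ (Expr PA Γ ts) (λ e′ →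
        (d : List ℕ) (B : Inst Γ) → d ≢ [] → OnDomain d B →
          eqR (eval e d B) (eval e′ d B) ≡ true))
    ×
    ((Γ : Schema) (ts : List Ty) (e′ : Expr PA Γ ts) →
      Σ (Expr EA Γ ts) (λ e →
        (d : List ℕ) (B : Inst Γ) → d ≢ [] → OnDomain d B →
          eqR (eval e d B) (eval e′ d B) ≡ true))
proposition4p4 =
  (λ Γ ts e → toPA e , λ d B d≢[] _ → ≈ʳ⇒eqR (toPA-sound d≢[] e B)) ,
  (λ Γ ts e′ → toEA id e′ , λ d B _ B-on → ≈ʳ⇒eqR (toEA-sound d id (λ _ → ≈ʳ-refl) B-on e′))
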